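{- Let $q=2^r$ and $m\in\mathbb{Z}_{>0}$. For each $\beta\in\mathbb{F}_q$: (1) $\sigma(m,q;\beta)=\sum\lambda(\alpha_1+\cdots+\alpha_m)+q^{ -1}\{(q-1)^m+(-1)^{m+1}\}$, where the sum runs over all $\alpha_1,\dots,\alpha_m\in\mathbb{F}_q^*$ satisfying $\alpha_1^{ -1}+\cdots+\alpha_m^{ -1}=\beta$. (2) $\sigma(2,q;0)=2q-3$, and $\sigma(2,q;\beta)=K(\lambda;\beta^{ -1})+q-3$ for $\beta\ne0$.
   Context: $tr:\mathbb{F}_q\to\mathbb{F}_2$ is the absolute trace, $\lambda(x)=(-1)^{tr(x)}$, $K(\lambda;a)=\sum_{\alpha\in\mathbb{F}_q^*}\lambda(\alpha+a\alpha^{ -1})$ for $a\in\mathbb{F}_q^*$. For $\beta\in\mathbb{F}_q$, $\sigma(m,q;\beta)=|\{(\alpha_1,\dots,\alpha_m)\in(\mathbb{F}_q^*)^m:\alpha_1+\cdots+\alpha_m+\alpha_1^{ -1}+\cdots+\alpha_m^{ -1}=\beta\}|$. -}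

module Defs where

open import Level using (0ℓ)
open import Algebra.Bundles using (CommutativeRing)
open import Data.Nat as ℕ using (ℕ; zero; suc)
open import Data.Integer as ℤ using (ℤ; +_)
open import Data.List as List using (List; []; _∷_; filter; length; map; concatMap)
open import Data.List.Relation.Unary.Any using (Any)
open import Data.List.Relation.Unary.AllPairs using (AllPairs)
open import Data.Vec as Vec using (Vec; []; _∷_)
open import Data.Product using (Σ; ∃; _×_; _,_)
open import Relation.Nullary using (¬_; Dec; yes; no)
open import Relation.Binary using (Decidable)

module FF (R : CommutativeRing 0ℓ 0ℓ)
          (_≟_ : Decidable (CommutativeRing._≈_ R))
          (elems : List (CommutativeRing.Carrier R))
          (inv : CommutativeRing.Carrier R → CommutativeRing.Carrier R)
          (r : ℕ) where

  open CommutativeRing R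

  IsFiniteFieldOfOrder2^ : Set
  IsFiniteFieldOfOrder2^ =
      ¬ (1# ≈ 0#)
    × (∀ x → ¬ (x ≈ 0#) → x * inv x ≈ 1#)
    × (∀ x → Any (x ≈_) elems)
    × AllPairs (λ a b → ¬ (a ≈ b)) elems
    × (length elems ≡ 2 ℕ.^ r)
    where open import Relation.Binary.PropositionalEquality using (_≡_)

  q : ℕ
  q = 2 ℕ.^ r

  nonzero : List Carrier
  nonzero = filter (λ x → Relation.Nullary.¬? (x ≟ 0#)) elems
    where import Relation.Nullary

  tuples : (m : ℕ) → List (Vec Carrier m)
  tuples zero    = [] ∷ []
  tuples (suc m) = concatMap (λ a → map (a ∷_) (tuples m)) nonzero

  sumF : ∀ {m} → Vec Carrier m → Carrier
  sumF = Vec.foldr _ _+_ 0#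

  sumInv : ∀ {m} → Vec Carrier m → Carrier
  sumInv v = sumF (Vec.map inv v)

  frob : ℕ → Carrier → Carrier
  frob zero    x = x
  frob (suc i) x = frob i x * frob i x

  tr : Carrier → Carrier
  tr x = List.foldr _+_ 0# (map (λ i → frob i x) (List.upTo r))

  lam : Carrier → ℤ
  lam x with tr x ≟ 0#
  ... | yes _ = + 1
  ... | no  _ = ℤ.- (+ 1)

  sumℤ : List ℤ → ℤ
  sumℤ = List.foldr ℤ._+_ (+ 0)

  K : Carrier → ℤ
  K a = sumℤ (map (λ α → lam (α + a * inv α)) nonzero)

  σ : (m : ℕ) → Carrier → ℕ
  σ m β = length (filter (λ v → (sumF v + sumInv v) ≟ β) (tuples m))

  S : (m : ℕ) → Carrier → ℤ
  S m β = sumℤ (map (λ v → lam (sumF v)) (filter (λ v → sumInv v ≟ β) (tuples m)))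

-- The trace is not identically zero (it is a linearized polynomial of degree 2^(r-1) < q, and a
-- linearized polynomial with a nonzero root v factors through x² + v x), so Σ_y λ(y z) is q for
-- z = 0 and 0 otherwise. Hence q σ(m,q;β) is the sum of λ(y (Σ αᵢ + Σ αᵢ⁻¹ + β)) over y ∈ F and
-- α ∈ (F*)^m. The term y = 0 gives (q-1)^m. For y ≠ 0 the substitution αᵢ ↦ αᵢ / y and
-- λ(y β) = λ(y² β²) turn the summand into λ(Σ αᵢ) λ(y² (Σ αᵢ⁻¹ + β²)); summing over y² ∈ F*
-- leaves q S(m,β²) - (-1)^m, and S(m,β²) = S(m,β) by squaring every αᵢ.
-- For m = 2 this says σ = S + q - 2. After inverting both variables, S(2,β) sums λ(a⁻¹ + b⁻¹)
-- over a + b = β: this is q - 1 for β = 0, and for β ≠ 0 a sum of λ(β / t) over t = a² + β a,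
-- each t occurring 1 + λ(t / β²) times (Artin–Schreier), which gives K(λ;β⁻¹) - 1.

{-# OPTIONS --safe #-}
module Submission where

open import Defs
open import Level using (0ℓ)
open import Algebra.Bundles using (CommutativeRing; CommutativeMonoid)
import Algebra.Properties.CommutativeSemigroup as CommutativeSemigroupProperties
import Algebra.Properties.CommutativeSemiring.Exp as Exp
import Algebra.Properties.Ring as RingProperties
open import Data.Bool using (true; false; if_then_else_)
open import Data.Integer as ℤ using (ℤ; +_; _≤_; +≤+; +<+)
import Data.Integer.Properties as ℤₚ
import Data.Integer.Tactic.RingSolver as ℤSolver
open import Data.List as List using (List; []; _∷_; map; foldr; filter; concatMap; _++_; length)
import Data.List.Membership.Propositional as Prop
import Data.List.Membership.Setoid.Properties as Membershipₚ
open import Data.List.Properties using (map-applyUpTo)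
open import Data.List.Relation.Unary.All.Properties using (All¬⇒¬Any)
open import Data.List.Relation.Unary.Any as Any using (Any; here; there)
import Data.List.Relation.Unary.Unique.Setoid.Properties as Uniqueₚ
open import Data.Maybe using (nothing)
open import Data.Nat as ℕ using (ℕ; zero; suc)
import Data.Nat.Properties as ℕₚ
open import Data.Product using (∃; _×_; _,_; proj₁; proj₂)
open import Data.Sum as Sum using (_⊎_; inj₁; inj₂)
open import Data.Vec as Vec using (Vec; []; _∷_)
open import Data.Vec.Relation.Binary.Pointwise.Inductive as Pointwise using (Pointwise; []; _∷_)
open import Data.Vec.Relation.Unary.All as AllV using ([]; _∷_)
open import Function using (_∘_; Inverse; mk⇔)
open import Relation.Binary using (Setoid; Decidable; _Preserves_⟶_; _Respects_)
open import Relation.Binary.PropositionalEquality as ≡ using (_≡_; _≢_)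
import Relation.Binary.Reasoning.Setoid
open import Relation.Nullary using (¬_; Dec; yes; no; does; ¬?)
open import Relation.Nullary.Decidable
  using (does-⇔; dec-true; dec-false; decidable-stable; _⊎-dec_; _×-dec_)
open import Relation.Nullary.Negation using (contradiction)
open import Relation.Unary using (Pred)
import Relation.Unary as U
open import Tactic.RingSolver using (solve-∀)
open import Tactic.RingSolver.Core.AlmostCommutativeRing
  using (AlmostCommutativeRing; fromCommutativeRing)

𝟙 : {P : Set} → Dec P → ℤ
𝟙 P? = if does P? then + 1 else + 0

𝟙-yes : ∀ {P : Set} (P? : Dec P) → P → 𝟙 P? ≡ + 1
𝟙-yes P? p = ≡.cong (λ b → if b then + 1 else + 0) (dec-true P? p)

𝟙-no : ∀ {P : Set} (P? : Dec P) → ¬ P → 𝟙 P? ≡ + 0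
𝟙-no P? ¬p = ≡.cong (λ b → if b then + 1 else + 0) (dec-false P? ¬p)

𝟙-⇔ : ∀ {P Q : Set} (P? : Dec P) (Q? : Dec Q) → (P → Q) → (Q → P) → 𝟙 P? ≡ 𝟙 Q?
𝟙-⇔ P? Q? P→Q Q→P = ≡.cong (λ b → if b then + 1 else + 0) (does-⇔ (mk⇔ P→Q Q→P) P? Q?)

if≡*𝟙 : ∀ {P : Set} (P? : Dec P) a → (if does P? then a else + 0) ≡ a ℤ.* 𝟙 P?
if≡*𝟙 (yes _) a = ≡.sym (ℤₚ.*-identityʳ a)
if≡*𝟙 (no _)  a = ≡.sym (ℤₚ.*-zeroʳ a)

*𝟙-cong : ∀ {P Q : Set} (P? : Dec P) (Q? : Dec Q) {x y} → (P → Q) → (Q → P) → (P → x ≡ y) →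
          x ℤ.* 𝟙 P? ≡ y ℤ.* 𝟙 Q?
*𝟙-cong (yes p) (yes _) _   _   x≡y = ≡.cong (ℤ._* + 1) (x≡y p)
*𝟙-cong (yes p) (no ¬q) P→Q _   _   = contradiction (P→Q p) ¬q
*𝟙-cong (no ¬p) (yes q) _   Q→P _   = contradiction (Q→P q) ¬p
*𝟙-cong (no _)  (no _)  {x} {y} _ _ _ = ≡.trans (ℤₚ.*-zeroʳ x) (≡.sym (ℤₚ.*-zeroʳ y))

𝟙-mono : ∀ {P Q : Set} (P? : Dec P) (Q? : Dec Q) → (P → Q) → 𝟙 P? ≤ 𝟙 Q?
𝟙-mono (yes _) (yes _) _   = ℤₚ.≤-refl
𝟙-mono (yes p) (no ¬q) P→Q = contradiction (P→Q p) ¬q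
𝟙-mono (no _)  (yes _) _   = +≤+ ℕ.z≤n
𝟙-mono (no _)  (no _)  _   = ℤₚ.≤-refl

𝟙-⊎-≤ : ∀ {P Q : Set} (P? : Dec P) (Q? : Dec Q) → 𝟙 (P? ⊎-dec Q?) ≤ 𝟙 P? ℤ.+ 𝟙 Q?
𝟙-⊎-≤ (yes _) (yes _) = +≤+ (ℕ.s≤s ℕ.z≤n)
𝟙-⊎-≤ (yes _) (no _)  = ℤₚ.≤-refl
𝟙-⊎-≤ (no _)  (yes _) = ℤₚ.≤-refl
𝟙-⊎-≤ (no _)  (no _)  = ℤₚ.≤-refl

𝟙*-mono-≤ : ∀ {P : Set} (P? : Dec P) {a b} → a ≤ b → 𝟙 P? ℤ.* a ≤ 𝟙 P? ℤ.* b
𝟙*-mono-≤ (yes _) {a} {b} a≤b =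
  ≡.subst₂ _≤_ (≡.sym (ℤₚ.*-identityˡ a)) (≡.sym (ℤₚ.*-identityˡ b)) a≤b
𝟙*-mono-≤ (no _)  _           = ℤₚ.≤-refl

module ListSum (M : CommutativeMonoid 0ℓ 0ℓ) where
  open CommutativeMonoid M
  open CommutativeSemigroupProperties commutativeSemigroup using (interchange)

  ∑ : {A : Set} → List A → (A → Carrier) → Carrier
  ∑ xs f = foldr _∙_ ε (map f xs)

  module _ {A : Set} where
    open Prop {A = A} using (_∈_)

    ∑-cong : ∀ xs {f g : A → Carrier} → (∀ x → f x ≈ g x) → ∑ xs f ≈ ∑ xs g
    ∑-cong []       f≈g = refl
    ∑-cong (x ∷ xs) f≈g = ∙-cong (f≈g x) (∑-cong xs f≈g)

    ∑-cong-∈ : ∀ xs {f g : A → Carrier} → (∀ {x} → x ∈ xs → f x ≈ g x) → ∑ xs f ≈ ∑ xs g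
    ∑-cong-∈ []       f≈g = refl
    ∑-cong-∈ (x ∷ xs) f≈g = ∙-cong (f≈g (here ≡.refl)) (∑-cong-∈ xs (f≈g ∘ there))

    ∑-ε : (xs : List A) → ∑ xs (λ _ → ε) ≈ ε
    ∑-ε []       = refl
    ∑-ε (x ∷ xs) = trans (identityˡ _) (∑-ε xs)

    ∑-∙ : ∀ xs (f g : A → Carrier) → ∑ xs (λ x → f x ∙ g x) ≈ ∑ xs f ∙ ∑ xs g
    ∑-∙ []       f g = sym (identityˡ ε)
    ∑-∙ (x ∷ xs) f g = trans (∙-congˡ (∑-∙ xs f g)) (interchange _ _ _ _)

    ∑-++ : ∀ xs ys (f : A → Carrier) → ∑ (xs ++ ys) f ≈ ∑ xs f ∙ ∑ ys f
    ∑-++ []       ys f = sym (identityˡ _)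
    ∑-++ (x ∷ xs) ys f = trans (∙-congˡ (∑-++ xs ys f)) (sym (assoc _ _ _))

    ∑-filter : {P : Pred A 0ℓ} (P? : U.Decidable P) (xs : List A) (f : A → Carrier) →
               ∑ (filter P? xs) f ≈ ∑ xs (λ x → if does (P? x) then f x else ε)
    ∑-filter P? []       f = refl
    ∑-filter P? (x ∷ xs) f with does (P? x)
    ... | true  = ∙-congˡ (∑-filter P? xs f)
    ... | false = trans (∑-filter P? xs f) (sym (identityˡ _))

  ∑-swap : ∀ {A B : Set} xs ys (f : A → B → Carrier) →
           ∑ xs (λ x → ∑ ys (f x)) ≈ ∑ ys (λ y → ∑ xs (λ x → f x y))
  ∑-swap []       ys f = sym (∑-ε ys)
  ∑-swap (x ∷ xs) ys f = trans (∙-congˡ (∑-swap xs ys f)) (sym (∑-∙ ys (f x) _))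

  ∑-map : ∀ {A B : Set} xs (g : A → B) (f : B → Carrier) → ∑ (map g xs) f ≈ ∑ xs (λ x → f (g x))
  ∑-map []       g f = refl
  ∑-map (x ∷ xs) g f = ∙-congˡ (∑-map xs g f)

  ∑-concatMap : ∀ {A B : Set} xs (g : A → List B) (f : B → Carrier) →
                ∑ (concatMap g xs) f ≈ ∑ xs (λ x → ∑ (g x) f)
  ∑-concatMap []       g f = refl
  ∑-concatMap (x ∷ xs) g f = trans (∑-++ (g x) (concatMap g xs) f) (∙-congˡ (∑-concatMap xs g f))

module Enumeration {S : Setoid 0ℓ 0ℓ} (_≟_ : Decidable (Setoid._≈_ S))
                   (M : CommutativeMonoid 0ℓ 0ℓ) where
  open Setoid S using ()
    renaming (Carrier to A; _≈_ to _≈ₛ_; reflexive to reflexiveₛ; sym to symₛ; trans to transₛ)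
  open CommutativeMonoid M
  open ListSum M
  open import Data.List.Membership.Setoid S using (_∈_; _∉_)
  open import Data.List.Relation.Unary.Unique.Setoid S using (Unique; _∷_)
  open import Relation.Binary.Reasoning.Setoid setoid

  ∈ₚ⇒∈ : ∀ {x xs} → x Prop.∈ xs → x ∈ xs
  ∈ₚ⇒∈ = Any.map reflexiveₛ

  ∑-δ-∉ : ∀ {y} xs (f : A → Carrier) → y ∉ xs →
          ∑ xs (λ x → if does (x ≟ y) then f x else ε) ≈ ε
  ∑-δ-∉ []           f y∉ = refl
  ∑-δ-∉ {y} (x ∷ xs) f y∉ with x ≟ y
  ... | yes x≈y = contradiction (here (symₛ x≈y)) y∉
  ... | no  _   = trans (identityˡ _) (∑-δ-∉ xs f (y∉ ∘ there))

  ∑-δ : ∀ {y xs} {f : A → Carrier} → f Preserves _≈ₛ_ ⟶ _≈_ → Unique xs → y ∈ xs →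
        ∑ xs (λ x → if does (x ≟ y) then f x else ε) ≈ f y
  ∑-δ {y} {x ∷ xs} {f} f-cong (x∉xs ∷ unique) y∈ with x ≟ y | y∈
  ... | yes x≈y | _ = begin
    f x ∙ ∑ xs (λ z → if does (z ≟ y) then f z else ε) ≈⟨ ∙-congˡ (∑-δ-∉ xs f y∉xs) ⟩
    f x ∙ ε                                             ≈⟨ identityʳ _ ⟩
    f x                                                 ≈⟨ f-cong x≈y ⟩
    f y                                                 ∎
    where y∉xs = λ y∈xs → All¬⇒¬Any x∉xs (Any.map (transₛ x≈y) y∈xs)
  ... | no x≉y | here y≈x      = contradiction (symₛ y≈x) x≉y
  ... | no _   | there y∈xs    = trans (identityˡ _) (∑-δ f-cong unique y∈xs)

  ∑-fibres : ∀ {xs} {g : A → A} {h : A → Carrier} → h Preserves _≈ₛ_ ⟶ _≈_ → Unique xs →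
             (∀ {x} → x ∈ xs → g x ∈ xs) →
             ∑ xs (λ x → h (g x)) ≈ ∑ xs (λ y → ∑ xs (λ x → if does (y ≟ g x) then h y else ε))
  ∑-fibres {xs} h-cong unique g∈ =
    trans (∑-cong-∈ xs (λ x∈ → sym (∑-δ h-cong unique (g∈ (∈ₚ⇒∈ x∈))))) (∑-swap xs xs _)

  ∑-bijection : ∀ {xs} {h : A → Carrier} (φ : Inverse S S) → h Preserves _≈ₛ_ ⟶ _≈_ →
                Unique xs → (∀ {x} → x ∈ xs → Inverse.to φ x ∈ xs) →
                (∀ {y} → y ∈ xs → Inverse.from φ y ∈ xs) →
                ∑ xs (λ x → h (Inverse.to φ x)) ≈ ∑ xs h
  ∑-bijection {xs} {h} φ h-cong unique to∈ from∈ = begin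
    ∑ xs (λ x → h (to x))
      ≈⟨ ∑-fibres h-cong unique to∈ ⟩
    ∑ xs (λ y → ∑ xs (λ x → if does (y ≟ to x) then h y else ε))
      ≈⟨ ∑-cong xs (λ y → ∑-cong xs (λ x → reflexive (≡.cong (λ b → if b then h y else ε)
           (does-⇔ (mk⇔ (symₛ ∘ inverseʳ) (symₛ ∘ inverseˡ)) (y ≟ to x) (x ≟ from y))))) ⟩
    ∑ xs (λ y → ∑ xs (λ x → if does (x ≟ from y) then h y else ε))
      ≈⟨ ∑-cong-∈ xs (λ y∈ → ∑-δ (λ _ → refl) unique (from∈ (∈ₚ⇒∈ y∈))) ⟩
    ∑ xs h ∎
    where open Inverse φ

module IntegerSum where
  open ListSum ℤₚ.+-0-commutativeMonoid public
  open import Algebra.Properties.AbelianGroup ℤₚ.+-0-abelianGroup using (∙-cancelˡ)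

  module _ {A : Set} where
    open Prop {A = A} using (_∈_)

    ∑-ones : (xs : List A) → ∑ xs (λ _ → + 1) ≡ + length xs
    ∑-ones []       = ≡.refl
    ∑-ones (x ∷ xs) = ≡.cong (λ s → + 1 ℤ.+ s) (∑-ones xs)

    length-filter : ∀ {P : Pred A 0ℓ} (P? : U.Decidable P) xs →
                    + length (filter P? xs) ≡ ∑ xs (λ x → 𝟙 (P? x))
    length-filter P? xs = ≡.trans (≡.sym (∑-ones (filter P? xs))) (∑-filter P? xs (λ _ → + 1))

    ∑-*ˡ : ∀ (xs : List A) c f → ∑ xs (λ x → c ℤ.* f x) ≡ c ℤ.* ∑ xs f
    ∑-*ˡ []       c f = ≡.sym (ℤₚ.*-zeroʳ c)
    ∑-*ˡ (x ∷ xs) c f =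
      ≡.trans (≡.cong (λ s → c ℤ.* f x ℤ.+ s) (∑-*ˡ xs c f)) (≡.sym (ℤₚ.*-distribˡ-+ c _ _))

    ∑-*ʳ : ∀ (xs : List A) c f → ∑ xs (λ x → f x ℤ.* c) ≡ ∑ xs f ℤ.* c
    ∑-*ʳ xs c f =
      ≡.trans (∑-cong xs (λ x → ℤₚ.*-comm (f x) c)) (≡.trans (∑-*ˡ xs c f) (ℤₚ.*-comm c _))

    ∑-mono-≤ : ∀ (xs : List A) {f g} → (∀ x → f x ≤ g x) → ∑ xs f ≤ ∑ xs g
    ∑-mono-≤ []       f≤g = ℤₚ.≤-refl
    ∑-mono-≤ (x ∷ xs) f≤g = ℤₚ.+-mono-≤ (f≤g x) (∑-mono-≤ xs f≤g)

    ∑-mono-≤-≡⇒≡ : ∀ (xs : List A) {f g} → (∀ x → f x ≤ g x) → ∑ xs f ≡ ∑ xs g →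
                   ∀ {x} → x ∈ xs → f x ≡ g x
    ∑-mono-≤-≡⇒≡ (y ∷ xs) {f} {g} f≤g ∑f≡∑g (here ≡.refl) =
      ℤₚ.≤-antisym (f≤g y) (≤-cancelʳ (∑ xs g) (begin
        g y ℤ.+ ∑ xs g  ≡⟨ ≡.sym ∑f≡∑g ⟩
        f y ℤ.+ ∑ xs f  ≤⟨ ℤₚ.+-monoʳ-≤ (f y) (∑-mono-≤ xs f≤g) ⟩
        f y ℤ.+ ∑ xs g  ∎))
      where
      open ℤₚ.≤-Reasoning
      [a+c]-c≡a : ∀ a c → a ℤ.+ c ℤ.- c ≡ a
      [a+c]-c≡a = ℤSolver.solve-∀
      ≤-cancelʳ : ∀ {a b} c → a ℤ.+ c ≤ b ℤ.+ c → a ≤ b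
      ≤-cancelʳ {a} {b} c a+c≤b+c =
        ≡.subst₂ _≤_ ([a+c]-c≡a a c) ([a+c]-c≡a b c) (ℤₚ.+-monoˡ-≤ (ℤ.- c) a+c≤b+c)
    ∑-mono-≤-≡⇒≡ (y ∷ xs) {f} {g} f≤g ∑f≡∑g (there x∈xs) = ∑-mono-≤-≡⇒≡ xs f≤g ∑f≡∑g′ x∈xs
      where
      fy≡gy = ∑-mono-≤-≡⇒≡ (y ∷ xs) f≤g ∑f≡∑g (here ≡.refl)
      ∑f≡∑g′ = ∙-cancelˡ (g y) _ _ (≡.trans (≡.cong (λ s → s ℤ.+ ∑ xs f) (≡.sym fy≡gy)) ∑f≡∑g)

module FiniteField (R : CommutativeRing 0ℓ 0ℓ)
                   (_≟_ : Decidable (CommutativeRing._≈_ R))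
                   (elems : List (CommutativeRing.Carrier R))
                   (inv : CommutativeRing.Carrier R → CommutativeRing.Carrier R)
                   (r : ℕ)
                   (isField : FF.IsFiniteFieldOfOrder2^ R _≟_ elems inv r) where

  open CommutativeRing R
  open FF R _≟_ elems inv r
  module ≈-Reasoning = Relation.Binary.Reasoning.Setoid setoid
  open import Data.List.Membership.Setoid setoid using (_∈_; _∉_)
  open import Data.List.Relation.Unary.Unique.Setoid setoid using (Unique)

  1≉0 : 1# ≉ 0#
  1≉0 = proj₁ isField

  inv-inverseʳ : ∀ x → x ≉ 0# → x * inv x ≈ 1#
  inv-inverseʳ = proj₁ (proj₂ isField)

  elems-complete : ∀ x → x ∈ elems
  elems-complete = proj₁ (proj₂ (proj₂ isField))

  elems-unique : Unique elems
  elems-unique = proj₁ (proj₂ (proj₂ (proj₂ isField)))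

  length-elems : length elems ≡ q
  length-elems = proj₂ (proj₂ (proj₂ (proj₂ isField)))

  -- Unlike inv, which is unspecified at 0, this respects ≈ everywhere.
  _⁻¹ : Carrier → Carrier
  x ⁻¹ = if does (x ≟ 0#) then 0# else inv x

  ⁻¹-zero : ∀ {x} → x ≈ 0# → x ⁻¹ ≈ 0#
  ⁻¹-zero {x} x≈0 with x ≟ 0#
  ... | yes _   = refl
  ... | no x≉0 = contradiction x≈0 x≉0

  inv≈⁻¹ : ∀ {x} → x ≉ 0# → inv x ≈ x ⁻¹
  inv≈⁻¹ {x} x≉0 with x ≟ 0#
  ... | yes x≈0 = contradiction x≈0 x≉0
  ... | no _    = refl

  ⁻¹-inverseʳ : ∀ {x} → x ≉ 0# → x * x ⁻¹ ≈ 1#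
  ⁻¹-inverseʳ {x} x≉0 = trans (*-congˡ (sym (inv≈⁻¹ x≉0))) (inv-inverseʳ x x≉0)

  ⁻¹-inverseˡ : ∀ {x} → x ≉ 0# → x ⁻¹ * x ≈ 1#
  ⁻¹-inverseˡ x≉0 = trans (*-comm _ _) (⁻¹-inverseʳ x≉0)

  ⁻¹-*-cancelˡ : ∀ {c} → c ≉ 0# → ∀ x → c ⁻¹ * (c * x) ≈ x
  ⁻¹-*-cancelˡ c≉0 x = trans (sym (*-assoc _ _ _)) (trans (*-congʳ (⁻¹-inverseˡ c≉0)) (*-identityˡ x))

  *-⁻¹-cancelˡ : ∀ {c} → c ≉ 0# → ∀ x → c * (c ⁻¹ * x) ≈ x
  *-⁻¹-cancelˡ c≉0 x = trans (sym (*-assoc _ _ _)) (trans (*-congʳ (⁻¹-inverseʳ c≉0)) (*-identityˡ x))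

  *-cancelˡ : ∀ {c x y} → c ≉ 0# → c * x ≈ c * y → x ≈ y
  *-cancelˡ {c} {x} {y} c≉0 cx≈cy = begin
    x               ≈⟨ sym (⁻¹-*-cancelˡ c≉0 x) ⟩
    c ⁻¹ * (c * x)  ≈⟨ *-congˡ cx≈cy ⟩
    c ⁻¹ * (c * y)  ≈⟨ ⁻¹-*-cancelˡ c≉0 y ⟩
    y               ∎
    where open ≈-Reasoning

  x≉0∧xy≈0⇒y≈0 : ∀ {x y} → x ≉ 0# → x * y ≈ 0# → y ≈ 0#
  x≉0∧xy≈0⇒y≈0 {x} {y} x≉0 xy≈0 = *-cancelˡ x≉0 (trans xy≈0 (sym (zeroʳ x)))

  zero-product : ∀ {x y} → x * y ≈ 0# → x ≈ 0# ⊎ y ≈ 0#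
  zero-product {x} xy≈0 with x ≟ 0#
  ... | yes x≈0 = inj₁ x≈0
  ... | no  x≉0 = inj₂ (x≉0∧xy≈0⇒y≈0 x≉0 xy≈0)

  *-≉0 : ∀ {x y} → x ≉ 0# → y ≉ 0# → x * y ≉ 0#
  *-≉0 x≉0 y≉0 xy≈0 = y≉0 (x≉0∧xy≈0⇒y≈0 x≉0 xy≈0)

  ⁻¹-unique : ∀ {x y} → x * y ≈ 1# → y ≈ x ⁻¹
  ⁻¹-unique {x} {y} xy≈1 = begin
    y               ≈⟨ sym (⁻¹-*-cancelˡ x≉0 y) ⟩
    x ⁻¹ * (x * y)  ≈⟨ *-congˡ xy≈1 ⟩
    x ⁻¹ * 1#       ≈⟨ *-identityʳ _ ⟩
    x ⁻¹            ∎
    where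
    open ≈-Reasoning
    x≉0 : x ≉ 0#
    x≉0 = λ x≈0 → 1≉0 (trans (sym xy≈1) (trans (*-congʳ x≈0) (zeroˡ y)))

  ⁻¹-≉0 : ∀ {x} → x ≉ 0# → x ⁻¹ ≉ 0#
  ⁻¹-≉0 {x} x≉0 x⁻¹≈0 = 1≉0 (trans (sym (⁻¹-inverseʳ x≉0)) (trans (*-congˡ x⁻¹≈0) (zeroʳ x)))

  ⁻¹-cong : ∀ {x y} → x ≈ y → x ⁻¹ ≈ y ⁻¹
  ⁻¹-cong {x} {y} x≈y with x ≟ 0#
  ... | yes x≈0 = sym (⁻¹-zero (trans (sym x≈y) x≈0))
  ... | no  x≉0 = trans (inv≈⁻¹ x≉0) (sym (⁻¹-unique (trans (*-congʳ x≈y) (⁻¹-inverseʳ (x≉0 ∘ trans x≈y)))))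

  ⁻¹-involutive : ∀ x → x ⁻¹ ⁻¹ ≈ x
  ⁻¹-involutive x with x ≟ 0#
  ... | yes x≈0 = trans (⁻¹-zero refl) (sym x≈0)
  ... | no  x≉0 = trans (⁻¹-cong (inv≈⁻¹ x≉0)) (sym (⁻¹-unique (⁻¹-inverseˡ x≉0)))

  ⁻¹-distrib-* : ∀ x y → (x * y) ⁻¹ ≈ x ⁻¹ * y ⁻¹
  ⁻¹-distrib-* x y with x ≟ 0# | y ≟ 0#
  ... | yes x≈0 | _       = trans (⁻¹-zero (trans (*-congʳ x≈0) (zeroˡ y))) (sym (zeroˡ _))
  ... | no _    | yes y≈0 = trans (⁻¹-zero (trans (*-congˡ y≈0) (zeroʳ x))) (sym (zeroʳ _))
  ... | no x≉0  | no y≉0  = sym (⁻¹-unique (begin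
    (x * y) * (inv x * inv y)  ≈⟨ *-interchange x y (inv x) (inv y) ⟩
    (x * inv x) * (y * inv y)  ≈⟨ *-cong (inv-inverseʳ x x≉0) (inv-inverseʳ y y≉0) ⟩
    1# * 1#                    ≈⟨ *-identityˡ 1# ⟩
    1#                         ∎))
    where
    open ≈-Reasoning
    open CommutativeSemigroupProperties *-commutativeSemigroup renaming (interchange to *-interchange)

  ⁻¹-+ : ∀ {a b} → a ≉ 0# → b ≉ 0# → a ⁻¹ + b ⁻¹ ≈ (a + b) * (a * b) ⁻¹
  ⁻¹-+ {a} {b} a≉0 b≉0 = begin
    a ⁻¹ + b ⁻¹
      ≈⟨ +-comm _ _ ⟩
    b ⁻¹ + a ⁻¹
      ≈⟨ sym (+-cong (*-⁻¹-cancelˡ a≉0 (b ⁻¹))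
         (trans (*-congˡ (*-comm _ _)) (*-⁻¹-cancelˡ b≉0 (a ⁻¹)))) ⟩
    a * (a ⁻¹ * b ⁻¹) + b * (a ⁻¹ * b ⁻¹)
      ≈⟨ sym (distribʳ _ a b) ⟩
    (a + b) * (a ⁻¹ * b ⁻¹)
      ≈⟨ *-congˡ (sym (⁻¹-distrib-* a b)) ⟩
    (a + b) * (a * b) ⁻¹
      ∎
    where open ≈-Reasoning

  automorphism : (f g : Carrier → Carrier) → f Preserves _≈_ ⟶ _≈_ → g Preserves _≈_ ⟶ _≈_ →
                 (∀ x → f (g x) ≈ x) → (∀ x → g (f x) ≈ x) → Inverse setoid setoid
  automorphism f g f-cong g-cong fg gf = record
    { to = f ; from = g ; to-cong = f-cong ; from-cong = g-cong
    ; inverse = (λ {x} y≈gx → trans (f-cong y≈gx) (fg x)) , (λ {x} y≈fx → trans (g-cong y≈fx) (gf x))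
    }

  scaling : ∀ {c} → c ≉ 0# → Inverse setoid setoid
  scaling {c} c≉0 = automorphism (c *_) (c ⁻¹ *_) *-congˡ *-congˡ (*-⁻¹-cancelˡ c≉0) (⁻¹-*-cancelˡ c≉0)

  inversion : Inverse setoid setoid
  inversion = automorphism _⁻¹ _⁻¹ ⁻¹-cong ⁻¹-cong ⁻¹-involutive ⁻¹-involutive

  ≉0-resp-≈ : ∀ {x y} → x ≈ y → x ≉ 0# → y ≉ 0#
  ≉0-resp-≈ x≈y x≉0 = x≉0 ∘ trans x≈y

  ∈nonzero⇒≉0 : ∀ {x} → x ∈ nonzero → x ≉ 0#
  ∈nonzero⇒≉0 x∈ = proj₂ (Membershipₚ.∈-filter⁻ setoid (λ x → ¬? (x ≟ 0#)) ≉0-resp-≈ {xs = elems} x∈)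

  ≉0⇒∈nonzero : ∀ {x} → x ≉ 0# → x ∈ nonzero
  ≉0⇒∈nonzero {x} = Membershipₚ.∈-filter⁺ setoid (λ x → ¬? (x ≟ 0#)) ≉0-resp-≈ (elems-complete x)

  nonzero-unique : Unique nonzero
  nonzero-unique = Uniqueₚ.filter⁺ setoid (λ x → ¬? (x ≟ 0#)) elems-unique

  open IntegerSum
  open Enumeration {setoid} _≟_ ℤₚ.+-0-commutativeMonoid

  ∑F : (Carrier → ℤ) → ℤ
  ∑F = ∑ elems

  ∑F* : (Carrier → ℤ) → ℤ
  ∑F* = ∑ nonzero

  ∑F-bijection : ∀ {h} (φ : Inverse setoid setoid) → h Preserves _≈_ ⟶ _≡_ →
                 ∑F (λ x → h (Inverse.to φ x)) ≡ ∑F h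
  ∑F-bijection φ h-cong =
    ∑-bijection φ h-cong elems-unique (λ _ → elems-complete _) (λ _ → elems-complete _)

  ∑F*-bijection : ∀ {h} (φ : Inverse setoid setoid) → h Preserves _≈_ ⟶ _≡_ →
                  (∀ {x} → x ≉ 0# → Inverse.to φ x ≉ 0#) → (∀ {x} → x ≉ 0# → Inverse.from φ x ≉ 0#) →
                  ∑F* (λ x → h (Inverse.to φ x)) ≡ ∑F* h
  ∑F*-bijection φ h-cong to≉0 from≉0 = ∑-bijection φ h-cong nonzero-unique
    (≉0⇒∈nonzero ∘ to≉0 ∘ ∈nonzero⇒≉0) (≉0⇒∈nonzero ∘ from≉0 ∘ ∈nonzero⇒≉0)

  ∑F*-scaling : ∀ {c h} → c ≉ 0# → h Preserves _≈_ ⟶ _≡_ → ∑F* (λ x → h (c * x)) ≡ ∑F* h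
  ∑F*-scaling c≉0 h-cong = ∑F*-bijection (scaling c≉0) h-cong (*-≉0 c≉0) (*-≉0 (⁻¹-≉0 c≉0))

  ∑F*-inversion : ∀ {h} → h Preserves _≈_ ⟶ _≡_ → ∑F* (λ x → h (x ⁻¹)) ≡ ∑F* h
  ∑F*-inversion h-cong = ∑F*-bijection inversion h-cong ⁻¹-≉0 ⁻¹-≉0

  ∑F-split : ∀ {f} → f Preserves _≈_ ⟶ _≡_ → ∑F f ≡ f 0# ℤ.+ ∑F* f
  ∑F-split {f} f-cong = begin
    ∑F f
      ≡⟨ ∑-cong elems split ⟩
    ∑F (λ x → at0 x ℤ.+ off0 x)
      ≡⟨ ∑-∙ elems at0 off0 ⟩
    ∑F at0 ℤ.+ ∑F off0
      ≡⟨ ≡.cong₂ ℤ._+_ (∑-δ f-cong elems-unique (elems-complete 0#))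
         (≡.sym (∑-filter (λ x → ¬? (x ≟ 0#)) elems f)) ⟩
    f 0# ℤ.+ ∑F* f
      ∎
    where
    open ≡.≡-Reasoning
    at0 off0 : Carrier → ℤ
    at0  x = if does (x ≟ 0#) then f x else + 0
    off0 x = if does (¬? (x ≟ 0#)) then f x else + 0
    split : ∀ x → f x ≡ at0 x ℤ.+ off0 x
    split x with x ≟ 0#
    ... | yes _ = ≡.sym (ℤₚ.+-identityʳ (f x))
    ... | no  _ = ≡.sym (ℤₚ.+-identityˡ (f x))

  ∑F-restrict : ∀ {f} → f Preserves _≈_ ⟶ _≡_ → ∑F (λ t → f t ℤ.* 𝟙 (¬? (t ≟ 0#))) ≡ ∑F* f
  ∑F-restrict {f} f-cong = begin
    ∑F f′              ≡⟨ ∑F-split f′-cong ⟩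
    f′ 0# ℤ.+ ∑F* f′   ≡⟨ ≡.cong₂ ℤ._+_ f′0≡0 (∑-cong-∈ nonzero (λ t∈ → f′≡f (∈nonzero⇒≉0 (∈ₚ⇒∈ t∈)))) ⟩
    + 0 ℤ.+ ∑F* f      ≡⟨ ℤₚ.+-identityˡ _ ⟩
    ∑F* f              ∎
    where
    open ≡.≡-Reasoning
    f′ : Carrier → ℤ
    f′ t = f t ℤ.* 𝟙 (¬? (t ≟ 0#))
    f′-cong : f′ Preserves _≈_ ⟶ _≡_
    f′-cong {s} {t} s≈t =
      *𝟙-cong (¬? (s ≟ 0#)) (¬? (t ≟ 0#)) (≉0-resp-≈ s≈t) (≉0-resp-≈ (sym s≈t)) (λ _ → f-cong s≈t)
    f′0≡0 : f′ 0# ≡ + 0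
    f′0≡0 = ≡.trans (≡.cong (λ i → f 0# ℤ.* i) (𝟙-no (¬? (0# ≟ 0#)) (λ 0≉0 → 0≉0 refl))) (ℤₚ.*-zeroʳ (f 0#))
    f′≡f : ∀ {t} → t ≉ 0# → f′ t ≡ f t
    f′≡f {t} t≉0 = ≡.trans (≡.cong (λ i → f t ℤ.* i) (𝟙-yes (¬? (t ≟ 0#)) t≉0)) (ℤₚ.*-identityʳ (f t))

  ∑F*-point : ∀ {f} → f Preserves _≈_ ⟶ _≡_ → ∀ c → ∑F* (λ b → f b ℤ.* 𝟙 (b ≟ c)) ≡ f c ℤ.* 𝟙 (¬? (c ≟ 0#))
  ∑F*-point {f} f-cong c = ≡.trans (∑-cong nonzero (λ b → ≡.sym (if≡*𝟙 (b ≟ c) (f b)))) (point (c ≟ 0#))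
    where
    point : (c≟0 : Dec (c ≈ 0#)) → ∑F* (λ b → if does (b ≟ c) then f b else + 0) ≡ f c ℤ.* 𝟙 (¬? c≟0)
    point (yes c≈0) = ≡.trans (∑-δ-∉ nonzero f (λ c∈ → ∈nonzero⇒≉0 c∈ c≈0)) (≡.sym (ℤₚ.*-zeroʳ (f c)))
    point (no  c≉0) = ≡.trans (∑-δ f-cong nonzero-unique (≉0⇒∈nonzero c≉0)) (≡.sym (ℤₚ.*-identityʳ (f c)))

  q≡1+|F*| : q ≡ suc (length nonzero)
  q≡1+|F*| = ℤₚ.+-injective (begin
    + q                       ≡⟨ ≡.cong +_ (≡.sym length-elems) ⟩
    + length elems            ≡⟨ ≡.sym (∑-ones elems) ⟩
    ∑F (λ _ → + 1)            ≡⟨ ∑F-split (λ _ → ≡.refl) ⟩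
    + 1 ℤ.+ ∑F* (λ _ → + 1)   ≡⟨ ≡.cong (λ s → + 1 ℤ.+ s) (∑-ones nonzero) ⟩
    + suc (length nonzero)    ∎)
    where open ≡.≡-Reasoning

  |F*|≡q-1 : + length nonzero ≡ + q ℤ.- + 1
  |F*|≡q-1 = ≡.cong (λ n → + n ℤ.- + 1) (≡.sym q≡1+|F*|)

  -- Fermat's little theorem and characteristic 2

  open Exp commutativeSemiring using (_^_; ^-congˡ; ^-congʳ; ^-assocʳ; ^-homo-*)

  module _ where
    open ListSum *-commutativeMonoid using () renaming (∑ to ∏)
    open Enumeration {setoid} _≟_ *-commutativeMonoid using () renaming (∑-bijection to ∏-bijection)
    open CommutativeSemigroupProperties *-commutativeSemigroup using () renaming (interchange to *-interchange)

    ∏-scale : ∀ a xs → ∏ xs (a *_) ≈ a ^ length xs * ∏ xs (λ x → x)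
    ∏-scale a []       = sym (*-identityˡ 1#)
    ∏-scale a (x ∷ xs) = trans (*-congˡ (∏-scale a xs)) (*-interchange a x (a ^ length xs) _)

    ∏-≉0 : ∀ xs → (∀ {x} → x Prop.∈ xs → x ≉ 0#) → ∏ xs (λ x → x) ≉ 0#
    ∏-≉0 []       _   = 1≉0
    ∏-≉0 (x ∷ xs) ≉0 = *-≉0 (≉0 (here ≡.refl)) (∏-≉0 xs (≉0 ∘ there))

    fermat-≉0 : ∀ {a} → a ≉ 0# → a ^ length nonzero ≈ 1#
    fermat-≉0 {a} a≉0 = *-cancelˡ P≉0 (begin
      P * a ^ length nonzero  ≈⟨ *-comm _ _ ⟩
      a ^ length nonzero * P  ≈⟨ sym (∏-scale a nonzero) ⟩
      ∏ nonzero (a *_)        ≈⟨ ∏-bijection (scaling a≉0) (λ x≈y → x≈y) nonzero-unique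
                                   (≉0⇒∈nonzero ∘ *-≉0 a≉0 ∘ ∈nonzero⇒≉0)
                                   (≉0⇒∈nonzero ∘ *-≉0 (⁻¹-≉0 a≉0) ∘ ∈nonzero⇒≉0) ⟩
      P                       ≈⟨ sym (*-identityʳ P) ⟩
      P * 1#                  ∎)
      where
      open ≈-Reasoning
      P = ∏ nonzero (λ x → x)
      P≉0 = ∏-≉0 nonzero (∈nonzero⇒≉0 ∘ ∈ₚ⇒∈)

  fermat : ∀ a → a ^ q ≈ a
  fermat a with a ≟ 0#
  ... | yes a≈0 = trans (^-congʳ a q≡1+|F*|) (trans (*-congʳ a≈0) (trans (zeroˡ _) (sym a≈0)))
  ... | no  a≉0 = trans (^-congʳ a q≡1+|F*|) (trans (*-congˡ (fermat-≉0 a≉0)) (*-identityʳ a))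

  r≢0 : r ≢ 0
  r≢0 r≡0 = 1≉0 (at-most-one elems (≡.trans length-elems (≡.cong (2 ℕ.^_) r≡0))
                              (elems-complete 1#) (elems-complete 0#))
    where
    at-most-one : ∀ {x y} xs → length xs ≡ 1 → x ∈ xs → y ∈ xs → x ≈ y
    at-most-one (_ ∷ [])    _ (here x≈z) (here y≈z) = trans x≈z (sym y≈z)
    at-most-one (_ ∷ [])    _ (here _)   (there ())
    at-most-one (_ ∷ [])    _ (there ()) _
    at-most-one (_ ∷ _ ∷ _) ()

  r-1 : ℕ
  r-1 = ℕ.pred r

  r≡1+[r-1] : r ≡ suc r-1
  r≡1+[r-1] = ≡.sym (ℕₚ.suc-pred r {{ℕ.≢-nonZero r≢0}})

  1^n≈1 : ∀ n → 1# ^ n ≈ 1#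
  1^n≈1 zero    = refl
  1^n≈1 (suc n) = trans (*-identityˡ _) (1^n≈1 n)

  -- (-1)^q is -1 by Fermat and 1 since q is even.
  1+1≈0 : 1# + 1# ≈ 0#
  1+1≈0 = begin
    1# + 1#                 ≈⟨ +-congʳ 1≈-1 ⟩
    - 1# + 1#               ≈⟨ -‿inverseˡ 1# ⟩
    0#                      ∎
    where
    open ≈-Reasoning
    open RingProperties ring using (-1*x≈-x; -‿involutive)
    [-1]²≈1 : (- 1#) ^ 2 ≈ 1#
    [-1]²≈1 = trans (*-congˡ (*-identityʳ _)) (trans (-1*x≈-x (- 1#)) (-‿involutive 1#))
    1≈-1 : 1# ≈ - 1#
    1≈-1 = begin
      1#                          ≈⟨ sym (1^n≈1 (2 ℕ.^ r-1)) ⟩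
      1# ^ (2 ℕ.^ r-1)            ≈⟨ ^-congˡ (2 ℕ.^ r-1) (sym [-1]²≈1) ⟩
      ((- 1#) ^ 2) ^ (2 ℕ.^ r-1)  ≈⟨ ^-assocʳ (- 1#) 2 (2 ℕ.^ r-1) ⟩
      (- 1#) ^ (2 ℕ.^ suc r-1)    ≈⟨ ^-congʳ (- 1#) (≡.cong (2 ℕ.^_) (≡.sym r≡1+[r-1])) ⟩
      (- 1#) ^ q                  ≈⟨ fermat (- 1#) ⟩
      - 1#                        ∎

  x+x≈0 : ∀ x → x + x ≈ 0#
  x+x≈0 x = begin
    x + x              ≈⟨ sym (+-cong (*-identityˡ x) (*-identityˡ x)) ⟩
    1# * x + 1# * x    ≈⟨ sym (distribʳ x 1# 1#) ⟩
    (1# + 1#) * x      ≈⟨ *-congʳ 1+1≈0 ⟩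
    0# * x             ≈⟨ zeroˡ x ⟩
    0#                 ∎
    where open ≈-Reasoning

  x+[x+y]≈y : ∀ x y → x + (x + y) ≈ y
  x+[x+y]≈y x y = trans (sym (+-assoc x x y)) (trans (+-congʳ (x+x≈0 x)) (+-identityˡ y))

  +≈0⇒≈ : ∀ {x y} → x + y ≈ 0# → x ≈ y
  +≈0⇒≈ {x} {y} x+y≈0 = trans (sym (x+[x+y]≈y y x)) (trans (+-congˡ (trans (+-comm y x) x+y≈0)) (+-identityʳ y))

  ≈⇒+≈0 : ∀ {x y} → x ≈ y → x + y ≈ 0#
  ≈⇒+≈0 {x} {y} x≈y = trans (+-congʳ x≈y) (x+x≈0 y)

  private
    ring′ : AlmostCommutativeRing 0ℓ 0ℓ
    ring′ = fromCommutativeRing R (λ _ → nothing)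

  square-+ : ∀ x y → (x + y) * (x + y) ≈ x * x + y * y
  square-+ x y = trans (expand x y) (trans (+-congˡ (x+x≈0 (x * y))) (+-identityʳ _))
    where
    open AlmostCommutativeRing ring′ using () renaming (_+_ to _⊕_; _*_ to _⊛_; _≈_ to _≋_)
    expand : ∀ a b → (a ⊕ b) ⊛ (a ⊕ b) ≋ (a ⊛ a ⊕ b ⊛ b) ⊕ (a ⊛ b ⊕ a ⊛ b)
    expand = solve-∀ ring′

  square-* : ∀ x y → (x * y) * (x * y) ≈ (x * x) * (y * y)
  square-* x y = interchange x y x y
    where open CommutativeSemigroupProperties *-commutativeSemigroup using (interchange)

  square-injective : ∀ {x y} → x * x ≈ y * y → x ≈ y
  square-injective {x} {y} x²≈y² = +≈0⇒≈ (Sum.reduce (zero-product (trans (square-+ x y) (≈⇒+≈0 x²≈y²))))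

  frob-cong : ∀ i {x y} → x ≈ y → frob i x ≈ frob i y
  frob-cong zero    x≈y = x≈y
  frob-cong (suc i) x≈y = *-cong (frob-cong i x≈y) (frob-cong i x≈y)

  frob-suc : ∀ i x → frob (suc i) x ≈ frob i (x * x)
  frob-suc zero    x = refl
  frob-suc (suc i) x = *-cong (frob-suc i x) (frob-suc i x)

  frob≈^ : ∀ i x → frob i x ≈ x ^ (2 ℕ.^ i)
  frob≈^ zero    x = sym (*-identityʳ x)
  frob≈^ (suc i) x = begin
    frob i x * frob i x            ≈⟨ *-cong (frob≈^ i x) (frob≈^ i x) ⟩
    x ^ n * x ^ n                  ≈⟨ sym (^-homo-* x n n) ⟩
    x ^ (n ℕ.+ n)                  ≈⟨ ^-congʳ x (≡.cong (n ℕ.+_) (≡.sym (ℕₚ.+-identityʳ n))) ⟩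
    x ^ (2 ℕ.^ suc i)              ∎
    where
    open ≈-Reasoning
    n = 2 ℕ.^ i

  frob-r : ∀ x → frob r x ≈ x
  frob-r x = trans (frob≈^ r x) (fermat x)

  √ : Carrier → Carrier
  √ = frob r-1

  √-square : ∀ x → √ x * √ x ≈ x
  √-square x = trans (reflexive (≡.cong (λ n → frob n x) (≡.sym r≡1+[r-1]))) (frob-r x)

  square-√ : ∀ x → √ (x * x) ≈ x
  square-√ x = square-injective (√-square (x * x))

  squaring : Inverse setoid setoid
  squaring = automorphism (λ x → x * x) √ (λ x≈y → *-cong x≈y x≈y) (frob-cong r-1) √-square square-√

  √-≉0 : ∀ {x} → x ≉ 0# → √ x ≉ 0#
  √-≉0 {x} x≉0 √x≈0 = x≉0 (trans (sym (√-square x)) (trans (*-congʳ √x≈0) (zeroˡ _)))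

  -- The absolute trace and λ

  partialTrace : ℕ → Carrier → Carrier
  partialTrace zero    x = 0#
  partialTrace (suc k) x = x + partialTrace k (x * x)

  partialTrace-cong : ∀ k {x y} → x ≈ y → partialTrace k x ≈ partialTrace k y
  partialTrace-cong zero    x≈y = refl
  partialTrace-cong (suc k) x≈y = +-cong x≈y (partialTrace-cong k (*-cong x≈y x≈y))

  partialTrace-+ : ∀ k x y → partialTrace k (x + y) ≈ partialTrace k x + partialTrace k y
  partialTrace-+ zero    x y = sym (+-identityˡ 0#)
  partialTrace-+ (suc k) x y = trans (+-congˡ (trans (partialTrace-cong k (square-+ x y)) (partialTrace-+ k _ _)))
                                     (interchange x y _ _)
    where open CommutativeSemigroupProperties +-commutativeSemigroup using (interchange)

  partialTrace-square : ∀ k x → partialTrace k x * partialTrace k x ≈ partialTrace k (x * x)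
  partialTrace-square zero    x = zeroˡ 0#
  partialTrace-square (suc k) x = trans (square-+ _ _) (+-congˡ (partialTrace-square k (x * x)))

  partialTrace-sucʳ : ∀ k x → partialTrace (suc k) x ≈ partialTrace k x + frob k x
  partialTrace-sucʳ zero    x = trans (+-identityʳ x) (sym (+-identityˡ x))
  partialTrace-sucʳ (suc k) x = trans (+-congˡ (partialTrace-sucʳ k (x * x)))
                                      (trans (sym (+-assoc _ _ _)) (+-congˡ (sym (frob-suc k x))))

  tr≈partialTrace : ∀ x → tr x ≈ partialTrace r x
  tr≈partialTrace x = trans (reflexive (≡.cong (foldr _+_ 0#) (map-applyUpTo (λ i → i) (λ i → frob i x) r)))
                            (applyUpTo-frob r x)
    where
    foldr-applyUpTo-cong : ∀ k {f g : ℕ → Carrier} → (∀ i → f i ≈ g i) →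
                           foldr _+_ 0# (List.applyUpTo f k) ≈ foldr _+_ 0# (List.applyUpTo g k)
    foldr-applyUpTo-cong zero    f≈g = refl
    foldr-applyUpTo-cong (suc k) f≈g = +-cong (f≈g 0) (foldr-applyUpTo-cong k (f≈g ∘ suc))
    applyUpTo-frob : ∀ k x → foldr _+_ 0# (List.applyUpTo (λ i → frob i x) k) ≈ partialTrace k x
    applyUpTo-frob zero    x = refl
    applyUpTo-frob (suc k) x =
      +-congˡ (trans (foldr-applyUpTo-cong k (λ i → frob-suc i x)) (applyUpTo-frob k (x * x)))

  tr-cong : ∀ {x y} → x ≈ y → tr x ≈ tr y
  tr-cong {x} {y} x≈y = trans (tr≈partialTrace x) (trans (partialTrace-cong r x≈y) (sym (tr≈partialTrace y)))

  tr-+ : ∀ x y → tr (x + y) ≈ tr x + tr y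
  tr-+ x y = trans (tr≈partialTrace _)
    (trans (partialTrace-+ r x y) (sym (+-cong (tr≈partialTrace x) (tr≈partialTrace y))))

  -- partialTrace (1 + r) x equals both x + tr (x²) and tr x + x^(2^r) = tr x + x.
  tr-square : ∀ x → tr (x * x) ≈ tr x
  tr-square x = begin
    tr (x * x)                       ≈⟨ sym (x+[x+y]≈y x _) ⟩
    x + (x + tr (x * x))             ≈⟨ +-congˡ (+-congˡ (tr≈partialTrace (x * x))) ⟩
    x + partialTrace (suc r) x       ≈⟨ +-congˡ (partialTrace-sucʳ r x) ⟩
    x + (partialTrace r x + frob r x) ≈⟨ +-congˡ (+-cong (sym (tr≈partialTrace x)) (frob-r x)) ⟩
    x + (tr x + x)                   ≈⟨ +-congˡ (+-comm _ x) ⟩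
    x + (x + tr x)                   ≈⟨ x+[x+y]≈y x _ ⟩
    tr x                             ∎
    where open ≈-Reasoning

  tr-℘ : ∀ u → tr (u * u + u) ≈ 0#
  tr-℘ u = trans (tr-+ _ _) (trans (+-congʳ (tr-square u)) (x+x≈0 _))

  tr-0 : tr 0# ≈ 0#
  tr-0 = trans (tr-cong (sym (trans (+-congʳ (zeroˡ 0#)) (+-identityˡ 0#)))) (tr-℘ 0#)

  tr≈0⊎tr≈1 : ∀ x → tr x ≈ 0# ⊎ tr x ≈ 1#
  tr≈0⊎tr≈1 x = Sum.map₂ +≈0⇒≈ (zero-product t[t+1]≈0)
    where
    t = tr x
    t[t+1]≈0 : t * (t + 1#) ≈ 0#
    t[t+1]≈0 = begin
      t * (t + 1#)
        ≈⟨ distribˡ t t 1# ⟩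
      t * t + t * 1#
        ≈⟨ +-cong (*-cong (tr≈partialTrace x) (tr≈partialTrace x)) (*-identityʳ t) ⟩
      partialTrace r x * partialTrace r x + t
        ≈⟨ +-congʳ (partialTrace-square r x) ⟩
      partialTrace r (x * x) + t
        ≈⟨ +-congʳ (trans (sym (tr≈partialTrace (x * x))) (tr-square x)) ⟩
      t + t
        ≈⟨ x+x≈0 t ⟩
      0#
        ∎
      where open ≈-Reasoning

  -1ℤ : ℤ
  -1ℤ = ℤ.- + 1

  lam-≈0 : ∀ {x} → tr x ≈ 0# → lam x ≡ + 1
  lam-≈0 {x} t≈0 with tr x ≟ 0#
  ... | yes _   = ≡.refl
  ... | no t≉0 = contradiction t≈0 t≉0

  lam-≉0 : ∀ {x} → tr x ≉ 0# → lam x ≡ -1ℤ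
  lam-≉0 {x} t≉0 with tr x ≟ 0#
  ... | yes t≈0 = contradiction t≈0 t≉0
  ... | no _    = ≡.refl

  lam-≈1 : ∀ {x} → tr x ≈ 1# → lam x ≡ -1ℤ
  lam-≈1 t≈1 = lam-≉0 (1≉0 ∘ trans (sym t≈1))

  lam-cong : ∀ {x y} → x ≈ y → lam x ≡ lam y
  lam-cong {x} x≈y with tr x ≟ 0#
  ... | yes t≈0 = ≡.sym (lam-≈0 (trans (sym (tr-cong x≈y)) t≈0))
  ... | no  t≉0 = ≡.sym (lam-≉0 (t≉0 ∘ trans (tr-cong x≈y)))

  lam-+ : ∀ x y → lam (x + y) ≡ lam x ℤ.* lam y
  lam-+ x y with tr≈0⊎tr≈1 x | tr≈0⊎tr≈1 y
  ... | inj₁ a | inj₁ b rewrite lam-≈0 a | lam-≈0 b = lam-≈0 (trans (tr-+ x y) (trans (+-cong a b) (+-identityʳ 0#)))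
  ... | inj₁ a | inj₂ b rewrite lam-≈0 a | lam-≈1 b = lam-≈1 (trans (tr-+ x y) (trans (+-cong a b) (+-identityˡ 1#)))
  ... | inj₂ a | inj₁ b rewrite lam-≈1 a | lam-≈0 b = lam-≈1 (trans (tr-+ x y) (trans (+-cong a b) (+-identityʳ 1#)))
  ... | inj₂ a | inj₂ b rewrite lam-≈1 a | lam-≈1 b = lam-≈0 (trans (tr-+ x y) (trans (+-cong a b) 1+1≈0))

  lam-square : ∀ x → lam (x * x) ≡ lam x
  lam-square x with tr x ≟ 0#
  ... | yes t≈0 = lam-≈0 (trans (tr-square x) t≈0)
  ... | no  t≉0 = lam-≉0 (t≉0 ∘ trans (sym (tr-square x)))

  lam-0 : lam 0# ≡ + 1
  lam-0 = lam-≈0 tr-0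


  count : {P : Pred Carrier 0ℓ} → U.Decidable P → ℤ
  count P? = ∑F (λ x → 𝟙 (P? x))

  #fibre : (Carrier → Carrier) → Carrier → ℤ
  #fibre g y = count (λ x → g x ≟ y)

  #fibre-cong : ∀ {g g′} → (∀ x → g x ≈ g′ x) → ∀ {y y′} → y ≈ y′ → #fibre g y ≡ #fibre g′ y′
  #fibre-cong {g} {g′} g≈g′ {y} {y′} y≈y′ = ∑-cong elems (λ x →
    𝟙-⇔ (g x ≟ y) (g′ x ≟ y′) (λ gx≈y → trans (sym (g≈g′ x)) (trans gx≈y y≈y′))
                              (λ g′x≈y′ → trans (g≈g′ x) (trans g′x≈y′ (sym y≈y′))))

  count-≈ : ∀ a → count (_≟ a) ≡ + 1
  count-≈ a = ∑-δ (λ _ → ≡.refl) elems-unique (elems-complete a)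

  count-mono : ∀ {P Q : Pred Carrier 0ℓ} (P? : U.Decidable P) (Q? : U.Decidable Q) →
               (∀ x → P x → Q x) → count P? ≤ count Q?
  count-mono P? Q? P⇒Q = ∑-mono-≤ elems (λ x → 𝟙-mono (P? x) (Q? x) (P⇒Q x))

  count-∅ : ∀ {P : Pred Carrier 0ℓ} (P? : U.Decidable P) → (∀ x → ¬ P x) → count P? ≡ + 0
  count-∅ P? ∅ = ≡.trans (∑-cong elems 𝟙≡0) (∑-ε elems)
    where
    𝟙≡0 : ∀ x → 𝟙 (P? x) ≡ + 0
    𝟙≡0 x with P? x
    ... | yes Px = contradiction Px (∅ x)
    ... | no _   = ≡.refl

  count-≤1 : ∀ {P : Pred Carrier 0ℓ} (P? : U.Decidable P) {a} → (∀ x → P x → x ≈ a) → count P? ≤ + 1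
  count-≤1 P? {a} P⇒≈a = ℤₚ.≤-trans (count-mono P? (_≟ a) P⇒≈a) (ℤₚ.≤-reflexive (count-≈ a))

  count-≤2 : ∀ {P : Pred Carrier 0ℓ} (P? : U.Decidable P) {a b} →
             (∀ x → P x → x ≈ a ⊎ x ≈ b) → count P? ≤ + 2
  count-≤2 P? {a} {b} P⇒≈a⊎≈b = begin
    count P?
      ≤⟨ count-mono P? (λ x → (x ≟ a) ⊎-dec (x ≟ b)) P⇒≈a⊎≈b ⟩
    count (λ x → (x ≟ a) ⊎-dec (x ≟ b))
      ≤⟨ ∑-mono-≤ elems (λ x → 𝟙-⊎-≤ (x ≟ a) (x ≟ b)) ⟩
    ∑F (λ x → 𝟙 (x ≟ a) ℤ.+ 𝟙 (x ≟ b))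
      ≡⟨ ≡.trans (∑-∙ elems _ _) (≡.cong₂ ℤ._+_ (count-≈ a) (count-≈ b)) ⟩
    + 2
      ∎
    where open ℤₚ.≤-Reasoning

  search : ∀ {P : Pred Carrier 0ℓ} → U.Decidable P → P Respects _≈_ → ∃ P ⊎ (∀ x → ¬ P x)
  search P? P-resp with Any.any? P? elems
  ... | yes some = inj₁ (Any.satisfied some)
  ... | no  none = inj₂ (λ x Px → none (Any.map (λ x≈y → P-resp x≈y Px) (elems-complete x)))

  ∑F-fibres : ∀ {h} g → h Preserves _≈_ ⟶ _≡_ → ∑F (λ x → h (g x)) ≡ ∑F (λ y → h y ℤ.* #fibre g y)
  ∑F-fibres {h} g h-cong = begin
    ∑F (λ x → h (g x))
      ≡⟨ ∑-fibres h-cong elems-unique (λ _ → elems-complete _) ⟩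
    ∑F (λ y → ∑F (λ x → if does (y ≟ g x) then h y else + 0))
      ≡⟨ ∑-cong elems (λ y → ≡.trans (∑-cong elems (fibre-term y)) (∑-*ˡ elems (h y) _)) ⟩
    ∑F (λ y → h y ℤ.* #fibre g y)
      ∎
    where
    open ≡.≡-Reasoning
    fibre-term : ∀ y x → (if does (y ≟ g x) then h y else + 0) ≡ h y ℤ.* 𝟙 (g x ≟ y)
    fibre-term y x = ≡.trans (if≡*𝟙 (y ≟ g x) (h y)) (≡.cong (λ i → h y ℤ.* i) (𝟙-⇔ (y ≟ g x) (g x ≟ y) sym sym))

  quadratic-solutions : ∀ {v y x₀ x} → x₀ * x₀ + v * x₀ ≈ y → x * x + v * x ≈ y → x ≈ x₀ ⊎ x ≈ x₀ + v
  quadratic-solutions {v} {y} {x₀} {x} x₀-sol x-sol = Sum.map +≈0⇒≈ +≈0⇒≈ (zero-product (begin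
    (x + x₀) * (x + (x₀ + v))
      ≈⟨ expand x x₀ v ⟩
    ((x * x + v * x) + (x₀ * x₀ + v * x₀)) + (x * x₀ + x * x₀)
      ≈⟨ +-cong (+-cong x-sol x₀-sol) (x+x≈0 _) ⟩
    (y + y) + 0#
      ≈⟨ trans (+-identityʳ _) (x+x≈0 y) ⟩
    0#
      ∎))
    where
    open ≈-Reasoning
    open AlmostCommutativeRing ring′ using () renaming (_+_ to _⊕_; _*_ to _⊛_; _≈_ to _≋_)
    expand : ∀ a b c → (a ⊕ b) ⊛ (a ⊕ (b ⊕ c)) ≋ ((a ⊛ a ⊕ c ⊛ a) ⊕ (b ⊛ b ⊕ c ⊛ b)) ⊕ (a ⊛ b ⊕ a ⊛ b)
    expand = solve-∀ ring′

  #fibre-quadratic-≤2 : ∀ v y → #fibre (λ x → x * x + v * x) y ≤ + 2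
  #fibre-quadratic-≤2 v y = Sum.[ (λ (x₀ , x₀-sol) → count-≤2 P? (λ x → quadratic-solutions {v} x₀-sol))
                              , (λ none → ℤₚ.≤-trans (ℤₚ.≤-reflexive (count-∅ P? none)) (+≤+ ℕ.z≤n))
                              ]′ (search P? (λ x≈z → trans (sym (+-cong (*-cong x≈z x≈z) (*-congˡ x≈z)))))
    where
    P? : U.Decidable (λ x → x * x + v * x ≈ y)
    P? x = (x * x + v * x) ≟ y

  -- Roots of linearized polynomials

  -- c₀ x + c₁ x² + ⋯ + c_{d-1} x^(2^(d-1)) + t x^(2^d) for cs = c₀ ∷ ⋯ ∷ c_{d-1}; the leading
  -- coefficient is kept apart so that quotient preserves it.
  evalLin : ∀ {d} → Vec Carrier d → Carrier → Carrier → Carrier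
  evalLin []       t x = t * x
  evalLin (c ∷ cs) t x = c * x + evalLin cs t (x * x)

  evalLin-cong : ∀ {d} (cs : Vec Carrier d) t {x y} → x ≈ y → evalLin cs t x ≈ evalLin cs t y
  evalLin-cong []       t x≈y = *-congˡ x≈y
  evalLin-cong (c ∷ cs) t x≈y = +-cong (*-congˡ x≈y) (evalLin-cong cs t (*-cong x≈y x≈y))

  evalLin-+-head : ∀ {d} a b (cs : Vec Carrier d) t x → evalLin ((a + b) ∷ cs) t x ≈ evalLin (a ∷ cs) t x + b * x
  evalLin-+-head a b cs t x = trans (+-congʳ (distribʳ x a b)) (xy∙z≈xz∙y _ _ _)
    where open CommutativeSemigroupProperties +-commutativeSemigroup using (xy∙z≈xz∙y)

  *[a+b]+[e+*a]≈*b+e : ∀ m a b e → m * (a + b) + (e + m * a) ≈ m * b + e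
  *[a+b]+[e+*a]≈*b+e m a b e = trans (expand m a b e) (trans (+-congˡ (x+x≈0 (m * a))) (+-identityʳ _))
    where
    open AlmostCommutativeRing ring′ using () renaming (_+_ to _⊕_; _*_ to _⊛_; _≈_ to _≋_)
    expand : ∀ m a b e → m ⊛ (a ⊕ b) ⊕ (e ⊕ m ⊛ a) ≋ (m ⊛ b ⊕ e) ⊕ (m ⊛ a ⊕ m ⊛ a)
    expand = solve-∀ ring′

  [cv⁻¹]v≈c : ∀ c {v} → v ≉ 0# → c * v ⁻¹ * v ≈ c
  [cv⁻¹]v≈c c v≉0 = trans (*-assoc c _ _) (trans (*-congˡ (⁻¹-inverseˡ v≉0)) (*-identityʳ c))

  -- The quotient by x² + v x of a linearized polynomial with nonzero root v.
  quotient : ∀ {d} → Vec Carrier (suc d) → Carrier → Vec Carrier d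
  quotient (c ∷ [])      v = []
  quotient (c ∷ c′ ∷ cs) v = c * v ⁻¹ ∷ quotient ((c′ + c * v ⁻¹) ∷ cs) (v * v)

  quotient-root : ∀ {d} c c′ (cs : Vec Carrier d) t {v} → v ≉ 0# → evalLin (c ∷ c′ ∷ cs) t v ≈ 0# →
                  evalLin ((c′ + c * v ⁻¹) ∷ cs) t (v * v) ≈ 0#
  quotient-root c c′ cs t {v} v≉0 root = begin
    evalLin ((c′ + c * v ⁻¹) ∷ cs) t (v * v)
      ≈⟨ evalLin-+-head c′ _ cs t (v * v) ⟩
    evalLin (c′ ∷ cs) t (v * v) + c * v ⁻¹ * (v * v)
      ≈⟨ +-congˡ (trans (sym (*-assoc _ v v)) (*-congʳ ([cv⁻¹]v≈c c v≉0))) ⟩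
    evalLin (c′ ∷ cs) t (v * v) + c * v
      ≈⟨ +-comm _ _ ⟩
    evalLin (c ∷ c′ ∷ cs) t v
      ≈⟨ root ⟩
    0#
      ∎
    where open ≈-Reasoning

  quotient-eval : ∀ {d} (cs : Vec Carrier (suc d)) t {v} → v ≉ 0# → evalLin cs t v ≈ 0# →
                  ∀ x → evalLin cs t x ≈ evalLin (quotient cs v) t (x * x + v * x)
  quotient-eval (c ∷ []) t {v} v≉0 root x = begin
    c * x + t * (x * x)        ≈⟨ +-comm _ _ ⟩
    t * (x * x) + c * x        ≈⟨ +-congˡ (*-congʳ c≈tv) ⟩
    t * (x * x) + t * v * x    ≈⟨ +-congˡ (*-assoc t v x) ⟩
    t * (x * x) + t * (v * x)  ≈⟨ sym (distribˡ t _ _) ⟩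
    t * (x * x + v * x)        ∎
    where
    open ≈-Reasoning
    cv⁻¹≈t : c * v ⁻¹ ≈ t
    cv⁻¹≈t = *-cancelˡ (*-≉0 v≉0 v≉0) (begin
      v * v * (c * v ⁻¹)  ≈⟨ *-comm _ _ ⟩
      c * v ⁻¹ * (v * v)  ≈⟨ trans (sym (*-assoc _ v v)) (*-congʳ ([cv⁻¹]v≈c c v≉0)) ⟩
      c * v               ≈⟨ +≈0⇒≈ root ⟩
      t * (v * v)         ≈⟨ *-comm _ _ ⟩
      v * v * t           ∎)
    c≈tv : c ≈ t * v
    c≈tv = trans (sym ([cv⁻¹]v≈c c v≉0)) (*-congʳ cv⁻¹≈t)
  quotient-eval (c ∷ c′ ∷ cs) t {v} v≉0 root x = begin
    c * x + evalLin (c′ ∷ cs) t (x * x)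
      ≈⟨ +-congʳ (*-congʳ (sym ([cv⁻¹]v≈c c v≉0))) ⟩
    m * v * x + evalLin (c′ ∷ cs) t (x * x)
      ≈⟨ +-congʳ (*-assoc m v x) ⟩
    m * (v * x) + evalLin (c′ ∷ cs) t (x * x)
      ≈⟨ sym (*[a+b]+[e+*a]≈*b+e m (x * x) (v * x) _) ⟩
    m * (x * x + v * x) + (evalLin (c′ ∷ cs) t (x * x) + m * (x * x))
      ≈⟨ +-congˡ (sym (evalLin-+-head c′ m cs t (x * x))) ⟩
    m * (x * x + v * x) + evalLin L′ t (x * x)
      ≈⟨ +-congˡ (quotient-eval L′ t (*-≉0 v≉0 v≉0) (quotient-root c c′ cs t v≉0 root) (x * x)) ⟩
    m * (x * x + v * x) + evalLin (quotient L′ (v * v)) t ((x * x) * (x * x) + (v * v) * (x * x))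
      ≈⟨ +-congˡ (evalLin-cong (quotient L′ (v * v)) t (sym (trans (square-+ _ _) (+-congˡ (square-* v x))))) ⟩
    m * (x * x + v * x) + evalLin (quotient L′ (v * v)) t ((x * x + v * x) * (x * x + v * x))
      ∎
    where
    open ≈-Reasoning
    m = c * v ⁻¹
    L′ = (c′ + m) ∷ cs

  #roots : ∀ {d} → Vec Carrier d → Carrier → ℤ
  #roots cs t = count (λ x → evalLin cs t x ≟ 0#)

  -- Each value of x² + v x is taken at most twice.
  #roots-quotient : ∀ {d} (cs : Vec Carrier (suc d)) t {v} → v ≉ 0# → evalLin cs t v ≈ 0# →
                    #roots cs t ≤ #roots (quotient cs v) t ℤ.* + 2
  #roots-quotient cs t {v} v≉0 root = begin
    #roots cs t
      ≡⟨ ∑-cong elems (λ x → 𝟙-⇔ (evalLin cs t x ≟ 0#) (evalLin M t (g x) ≟ 0#)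
           (trans (sym (quotient-eval cs t v≉0 root x))) (trans (quotient-eval cs t v≉0 root x))) ⟩
    ∑F (λ x → 𝟙 (evalLin M t (g x) ≟ 0#))
      ≡⟨ ∑F-fibres g (λ {y} {z} y≈z → 𝟙-⇔ (evalLin M t y ≟ 0#) (evalLin M t z ≟ 0#)
           (trans (evalLin-cong M t (sym y≈z))) (trans (evalLin-cong M t y≈z))) ⟩
    ∑F (λ y → 𝟙 (evalLin M t y ≟ 0#) ℤ.* #fibre g y)
      ≤⟨ ∑-mono-≤ elems (λ y → 𝟙*-mono-≤ (evalLin M t y ≟ 0#) (#fibre-quadratic-≤2 v y)) ⟩
    ∑F (λ y → 𝟙 (evalLin M t y ≟ 0#) ℤ.* + 2)
      ≡⟨ ∑-*ʳ elems (+ 2) _ ⟩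
    #roots M t ℤ.* + 2
      ∎
    where
    open ℤₚ.≤-Reasoning
    M = quotient cs v
    g = λ x → x * x + v * x

  #roots-≤ : ∀ {d} (cs : Vec Carrier d) {t} → t ≉ 0# → #roots cs t ≤ + (2 ℕ.^ d)
  #roots-≤ []       {t} t≉0 = count-≤1 (λ x → evalLin [] t x ≟ 0#) (λ x → x≉0∧xy≈0⇒y≈0 t≉0)
  #roots-≤ {suc d} (c ∷ cs) {t} t≉0 with search nonzero-root? nonzero-root-resp
    where
    NonzeroRoot : Pred Carrier 0ℓ
    NonzeroRoot v = v ≉ 0# × evalLin (c ∷ cs) t v ≈ 0#
    nonzero-root? : U.Decidable NonzeroRoot
    nonzero-root? v = ¬? (v ≟ 0#) ×-dec (evalLin (c ∷ cs) t v ≟ 0#)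
    nonzero-root-resp : NonzeroRoot Respects _≈_
    nonzero-root-resp v≈w (v≉0 , root) = ≉0-resp-≈ v≈w v≉0 , trans (evalLin-cong (c ∷ cs) t (sym v≈w)) root
  ... | inj₂ none = ℤₚ.≤-trans (count-≤1 (λ x → evalLin (c ∷ cs) t x ≟ 0#) only-0) (+≤+ (ℕₚ.m^n>0 2 (suc d)))
    where
    only-0 : ∀ x → evalLin (c ∷ cs) t x ≈ 0# → x ≈ 0#
    only-0 x root = decidable-stable (x ≟ 0#) (λ x≉0 → none x (x≉0 , root))
  ... | inj₁ (v , v≉0 , root) = begin
    #roots (c ∷ cs) t
      ≤⟨ #roots-quotient (c ∷ cs) t v≉0 root ⟩
    #roots (quotient (c ∷ cs) v) t ℤ.* + 2
      ≤⟨ ℤₚ.*-monoʳ-≤-nonNeg (+ 2) (#roots-≤ (quotient (c ∷ cs) v) t≉0) ⟩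
    + (2 ℕ.^ d) ℤ.* + 2
      ≡⟨ ≡.trans (≡.sym (ℤₚ.pos-* (2 ℕ.^ d) 2)) (≡.cong +_ (ℕₚ.*-comm (2 ℕ.^ d) 2)) ⟩
    + (2 ℕ.^ suc d)
      ∎
    where open ℤₚ.≤-Reasoning

  evalLin-ones : ∀ d x → evalLin (Vec.replicate d 1#) 1# x ≈ partialTrace (suc d) x
  evalLin-ones zero    x = trans (*-identityˡ x) (sym (+-identityʳ x))
  evalLin-ones (suc d) x = +-cong (*-identityˡ x) (evalLin-ones d (x * x))

  -- tr is a polynomial of degree 2^(r-1) < q, so it cannot vanish on all of F.
  tr≉0 : ∃ λ a → tr a ≉ 0#
  tr≉0 with search (λ a → ¬? (tr a ≟ 0#)) (λ a≈b → _∘ trans (tr-cong a≈b))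
  ... | inj₁ found = found
  ... | inj₂ none  = contradiction q<q (ℤₚ.<-irrefl ≡.refl)
    where
    ones = Vec.replicate r-1 1#
    vanishes : ∀ x → evalLin ones 1# x ≈ 0#
    vanishes x = begin
      evalLin ones 1# x          ≈⟨ evalLin-ones r-1 x ⟩
      partialTrace (suc r-1) x   ≈⟨ partialTrace-cong′ ⟩
      partialTrace r x           ≈⟨ sym (tr≈partialTrace x) ⟩
      tr x                       ≈⟨ decidable-stable (tr x ≟ 0#) (none x) ⟩
      0#                         ∎
      where
      open ≈-Reasoning
      partialTrace-cong′ = reflexive (≡.cong (λ n → partialTrace n x) (≡.sym r≡1+[r-1]))
    #roots-ones≡q : #roots ones 1# ≡ + q
    #roots-ones≡q = begin
      #roots ones 1#     ≡⟨ ∑-cong elems (λ x → 𝟙-yes (evalLin ones 1# x ≟ 0#) (vanishes x)) ⟩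
      ∑F (λ _ → + 1)     ≡⟨ ∑-ones elems ⟩
      + length elems     ≡⟨ ≡.cong +_ length-elems ⟩
      + q                ∎
      where open ≡.≡-Reasoning
    2^[r-1]<q : 2 ℕ.^ r-1 ℕ.< q
    2^[r-1]<q = ≡.subst (λ n → 2 ℕ.^ r-1 ℕ.< 2 ℕ.^ n) (≡.sym r≡1+[r-1])
                        (ℕₚ.^-monoʳ-< 2 (ℕ.s≤s (ℕ.s≤s ℕ.z≤n)) (ℕₚ.n<1+n r-1))
    q<q : + q ℤ.< + q
    q<q = begin-strict
      + q               ≡⟨ ≡.sym #roots-ones≡q ⟩
      #roots ones 1#    ≤⟨ #roots-≤ ones 1≉0 ⟩
      + (2 ℕ.^ r-1)     <⟨ +<+ 2^[r-1]<q ⟩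
      + q               ∎
      where open ℤₚ.≤-Reasoning

  -- Character sums

  translation : Carrier → Inverse setoid setoid
  translation a = automorphism (_+ a) (_+ a) +-congʳ +-congʳ x+a+a≈x x+a+a≈x
    where
    x+a+a≈x : ∀ x → x + a + a ≈ x
    x+a+a≈x x = trans (+-assoc x a a) (trans (+-congˡ (x+x≈0 a)) (+-identityʳ x))

  -- Translating by an element of trace 1 changes the sign of every term.
  ∑F-lam : ∑F lam ≡ + 0
  ∑F-lam = s≡-s⇒s≡0 (begin
    ∑F lam
      ≡⟨ ≡.sym (∑F-bijection (translation a) lam-cong) ⟩
    ∑F (λ x → lam (x + a))
      ≡⟨ ∑-cong elems (λ x → ≡.trans (lam-+ x a) (≡.cong (λ i → lam x ℤ.* i) (lam-≉0 tr[a]≉0))) ⟩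
    ∑F (λ x → lam x ℤ.* -1ℤ)
      ≡⟨ ∑-*ʳ elems -1ℤ lam ⟩
    ∑F lam ℤ.* -1ℤ
      ≡⟨ ≡.trans (ℤₚ.*-comm _ -1ℤ) (ℤₚ.-1*i≡-i _) ⟩
    ℤ.- ∑F lam
      ∎)
    where
    open ≡.≡-Reasoning
    a = proj₁ tr≉0
    tr[a]≉0 = proj₂ tr≉0
    s≡-s⇒s≡0 : ∀ {s} → s ≡ ℤ.- s → s ≡ + 0
    s≡-s⇒s≡0 {+ zero}     _  = ≡.refl
    s≡-s⇒s≡0 {+ suc _}    ()
    s≡-s⇒s≡0 {ℤ.-[1+ _ ]} ()

  ∑F*-lam : ∑F* lam ≡ -1ℤ
  ∑F*-lam = ∙-cancelˡ (+ 1) _ _ (≡.trans (≡.cong (λ i → i ℤ.+ ∑F* lam) (≡.sym lam-0))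
                                         (≡.trans (≡.sym (∑F-split lam-cong)) ∑F-lam))
    where open import Algebra.Properties.AbelianGroup ℤₚ.+-0-abelianGroup using (∙-cancelˡ)

  orthogonality : ∀ z → ∑F (λ y → lam (y * z)) ≡ + q ℤ.* 𝟙 (z ≟ 0#)
  orthogonality z with z ≟ 0#
  ... | yes z≈0 = begin
    ∑F (λ y → lam (y * z))
      ≡⟨ ∑-cong elems (λ y → ≡.trans (lam-cong (trans (*-congˡ z≈0) (zeroʳ y))) lam-0) ⟩
    ∑F (λ _ → + 1)
      ≡⟨ ∑-ones elems ⟩
    + length elems
      ≡⟨ ≡.cong +_ length-elems ⟩
    + q
      ≡⟨ ≡.sym (ℤₚ.*-identityʳ (+ q)) ⟩
    + q ℤ.* + 1
      ∎
    where open ≡.≡-Reasoning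
  ... | no  z≉0 = begin
    ∑F (λ y → lam (y * z))  ≡⟨ ∑-cong elems (λ y → lam-cong (*-comm y z)) ⟩
    ∑F (λ y → lam (z * y))  ≡⟨ ∑F-bijection (scaling z≉0) lam-cong ⟩
    ∑F lam                  ≡⟨ ∑F-lam ⟩
    + 0                     ≡⟨ ≡.sym (ℤₚ.*-zeroʳ (+ q)) ⟩
    + q ℤ.* + 0             ∎
    where open ≡.≡-Reasoning

  ∑F*-lam-square : ∀ c → ∑F* (λ y → lam ((y * y) * c)) ≡ + q ℤ.* 𝟙 (c ≟ 0#) ℤ.- + 1
  ∑F*-lam-square c = begin
    ∑F* (λ y → lam ((y * y) * c))
      ≡⟨ ∑F*-bijection squaring (λ x≈y → lam-cong (*-congʳ x≈y)) (λ y≉0 → *-≉0 y≉0 y≉0) √-≉0 ⟩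
    ∑F* f
      ≡⟨ ≡.sym ([1+x]-1≡x (∑F* f)) ⟩
    + 1 ℤ.+ ∑F* f ℤ.- + 1
      ≡⟨ ≡.cong (λ i → i ℤ.+ ∑F* f ℤ.- + 1) (≡.sym (≡.trans (lam-cong (zeroˡ c)) lam-0)) ⟩
    f 0# ℤ.+ ∑F* f ℤ.- + 1
      ≡⟨ ≡.cong (ℤ._- + 1) (≡.sym (∑F-split (λ x≈y → lam-cong (*-congʳ x≈y)))) ⟩
    ∑F f ℤ.- + 1
      ≡⟨ ≡.cong (ℤ._- + 1) (orthogonality c) ⟩
    + q ℤ.* 𝟙 (c ≟ 0#) ℤ.- + 1
      ∎
    where
    open ≡.≡-Reasoning
    f = λ y → lam (y * c)
    [1+x]-1≡x : ∀ x → + 1 ℤ.+ x ℤ.- + 1 ≡ x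
    [1+x]-1≡x = ℤSolver.solve-∀

  -- Every s has at most 1 + λ(s) preimages under u ↦ u² + u, and both counts sum to q.
  #fibre-℘ : ∀ s → #fibre (λ u → u * u + u) s ≡ + 1 ℤ.+ lam s
  #fibre-℘ s with Prop.find (elems-complete s)
  ... | s′ , s′∈ , s≈s′ = begin
    #fibre ℘ s       ≡⟨ #fibre-cong (λ _ → refl) s≈s′ ⟩
    #fibre ℘ s′      ≡⟨ ∑-mono-≤-≡⇒≡ elems #fibre≤1+lam ∑#fibre≡∑[1+lam] s′∈ ⟩
    + 1 ℤ.+ lam s′   ≡⟨ ≡.cong (λ i → + 1 ℤ.+ i) (lam-cong (sym s≈s′)) ⟩
    + 1 ℤ.+ lam s    ∎
    where
    open ≡.≡-Reasoning
    ℘ = λ u → u * u + u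
    #fibre≤1+lam : ∀ s → #fibre ℘ s ℤ.≤ + 1 ℤ.+ lam s
    #fibre≤1+lam s with tr s ≟ 0#
    ... | yes _   = ℤₚ.≤-trans (ℤₚ.≤-reflexive (#fibre-cong (λ u → +-congˡ (sym (*-identityˡ u))) refl))
                              (#fibre-quadratic-≤2 1# s)
    ... | no t≉0 = ℤₚ.≤-reflexive (count-∅ (λ u → ℘ u ≟ s) (λ u ℘u≈s → t≉0 (trans (tr-cong (sym ℘u≈s)) (tr-℘ u))))
    ∑#fibre≡∑[1+lam] : ∑F (#fibre ℘) ≡ ∑F (λ s → + 1 ℤ.+ lam s)
    ∑#fibre≡∑[1+lam] = begin
      ∑F (λ s → ∑F (λ u → 𝟙 (℘ u ≟ s)))
        ≡⟨ ∑-swap elems elems _ ⟩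
      ∑F (λ u → ∑F (λ s → 𝟙 (℘ u ≟ s)))
        ≡⟨ ∑-cong elems (λ u → ≡.trans (∑-cong elems (λ s → 𝟙-⇔ (℘ u ≟ s) (s ≟ ℘ u) sym sym))
           (count-≈ (℘ u))) ⟩
      ∑F (λ _ → + 1)
        ≡⟨ ≡.sym (ℤₚ.+-identityʳ _) ⟩
      ∑F (λ _ → + 1) ℤ.+ + 0
        ≡⟨ ≡.cong (λ i → ∑F (λ _ → + 1) ℤ.+ i) (≡.sym ∑F-lam) ⟩
      ∑F (λ _ → + 1) ℤ.+ ∑F lam
        ≡⟨ ≡.sym (∑-∙ elems _ lam) ⟩
      ∑F (λ s → + 1 ℤ.+ lam s)
        ∎

  #fibre-quadratic : ∀ {β} → β ≉ 0# → ∀ t → #fibre (λ x → x * x + β * x) t ≡ + 1 ℤ.+ lam ((β * β) ⁻¹ * t)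
  #fibre-quadratic {β} β≉0 t = begin
    #fibre g t
      ≡⟨ ≡.sym (∑F-bijection (scaling β≉0) (λ x≈y →
         𝟙-⇔ (g _ ≟ t) (g _ ≟ t) (trans (sym (g-cong x≈y))) (trans (g-cong x≈y)))) ⟩
    ∑F (λ u → 𝟙 (g (β * u) ≟ t))
      ≡⟨ ∑-cong elems (λ u → 𝟙-⇔ (g (β * u) ≟ t) ((u * u + u) ≟ ((β * β) ⁻¹ * t))
         (λ eq → trans (sym (⁻¹-*-cancelˡ ββ≉0 _)) (*-congˡ (trans (sym (scaled u)) eq)))
         (λ eq → trans (scaled u) (trans (*-congˡ eq) (*-⁻¹-cancelˡ ββ≉0 t)))) ⟩
    #fibre (λ u → u * u + u) ((β * β) ⁻¹ * t)
      ≡⟨ #fibre-℘ _ ⟩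
    + 1 ℤ.+ lam ((β * β) ⁻¹ * t)
      ∎
    where
    open ≡.≡-Reasoning
    g = λ x → x * x + β * x
    g-cong : ∀ {x y} → x ≈ y → g x ≈ g y
    g-cong x≈y = +-cong (*-cong x≈y x≈y) (*-congˡ x≈y)
    ββ≉0 = *-≉0 β≉0 β≉0
    scaled : ∀ u → g (β * u) ≈ (β * β) * (u * u + u)
    scaled u = trans (+-cong (square-* β u) (sym (*-assoc β β u))) (sym (distribˡ _ _ u))

  sumInv′ : ∀ {m} → Vec Carrier m → Carrier
  sumInv′ v = sumF (Vec.map _⁻¹ v)

  sumInv≈sumInv′ : ∀ {m} {v : Vec Carrier m} → AllV.All (_≉ 0#) v → sumInv v ≈ sumInv′ v
  sumInv≈sumInv′ []            = refl
  sumInv≈sumInv′ (x≉0 ∷ v≉0) = +-cong (inv≈⁻¹ x≉0) (sumInv≈sumInv′ v≉0)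

  sumF-cong : ∀ {m} {u v : Vec Carrier m} → Pointwise _≈_ u v → sumF u ≈ sumF v
  sumF-cong []          = refl
  sumF-cong (x≈y ∷ u≈v) = +-cong x≈y (sumF-cong u≈v)

  sumInv′-cong : ∀ {m} {u v : Vec Carrier m} → Pointwise _≈_ u v → sumInv′ u ≈ sumInv′ v
  sumInv′-cong []          = refl
  sumInv′-cong (x≈y ∷ u≈v) = +-cong (⁻¹-cong x≈y) (sumInv′-cong u≈v)

  sumF-scale : ∀ c {m} (v : Vec Carrier m) → sumF (Vec.map (c *_) v) ≈ c * sumF v
  sumF-scale c []      = sym (zeroʳ c)
  sumF-scale c (x ∷ v) = trans (+-congˡ (sumF-scale c v)) (sym (distribˡ c x _))

  sumInv′-scale : ∀ c {m} (v : Vec Carrier m) → sumInv′ (Vec.map (c *_) v) ≈ c ⁻¹ * sumInv′ v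
  sumInv′-scale c []      = sym (zeroʳ _)
  sumInv′-scale c (x ∷ v) = trans (+-cong (⁻¹-distrib-* c x) (sumInv′-scale c v)) (sym (distribˡ _ _ _))

  sumF-square : ∀ {m} (v : Vec Carrier m) → sumF (Vec.map (λ x → x * x) v) ≈ sumF v * sumF v
  sumF-square []      = sym (zeroˡ 0#)
  sumF-square (x ∷ v) = trans (+-congˡ (sumF-square v)) (sym (square-+ x _))

  sumInv′-square : ∀ {m} (v : Vec Carrier m) → sumInv′ (Vec.map (λ x → x * x) v) ≈ sumInv′ v * sumInv′ v
  sumInv′-square []      = sym (zeroˡ 0#)
  sumInv′-square (x ∷ v) = trans (+-cong (⁻¹-distrib-* x x) (sumInv′-square v)) (sym (square-+ _ _))

  sumInv′-inverse : ∀ {m} (v : Vec Carrier m) → sumInv′ (Vec.map _⁻¹ v) ≈ sumF v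
  sumInv′-inverse []      = refl
  sumInv′-inverse (x ∷ v) = +-cong (⁻¹-involutive x) (sumInv′-inverse v)

  ∑ᵀ : (m : ℕ) → (Vec Carrier m → ℤ) → ℤ
  ∑ᵀ m = ∑ (tuples m)

  ∑ᵀ-suc : ∀ m h → ∑ᵀ (suc m) h ≡ ∑F* (λ a → ∑ᵀ m (λ v → h (a ∷ v)))
  ∑ᵀ-suc m h = ≡.trans (∑-concatMap nonzero _ h) (∑-cong nonzero (λ a → ∑-map (tuples m) (a ∷_) h))

  ∑ᵀ-cong-≉0 : ∀ m {h h′} → (∀ v → AllV.All (_≉ 0#) v → h v ≡ h′ v) → ∑ᵀ m h ≡ ∑ᵀ m h′
  ∑ᵀ-cong-≉0 zero    h≡h′ = ≡.cong (λ i → i ℤ.+ + 0) (h≡h′ [] [])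
  ∑ᵀ-cong-≉0 (suc m) {h} {h′} h≡h′ = begin
    ∑ᵀ (suc m) h
      ≡⟨ ∑ᵀ-suc m h ⟩
    ∑F* (λ a → ∑ᵀ m (λ v → h (a ∷ v)))
      ≡⟨ ∑-cong-∈ nonzero (λ a∈ → ∑ᵀ-cong-≉0 m (λ v v≉0 → h≡h′ _ (∈nonzero⇒≉0 (∈ₚ⇒∈ a∈) ∷ v≉0))) ⟩
    ∑F* (λ a → ∑ᵀ m (λ v → h′ (a ∷ v)))
      ≡⟨ ≡.sym (∑ᵀ-suc m h′) ⟩
    ∑ᵀ (suc m) h′
      ∎
    where open ≡.≡-Reasoning

  ∑ᵀ-map : ∀ m (φ : Inverse setoid setoid) →
           (∀ {x} → x ≉ 0# → Inverse.to φ x ≉ 0#) → (∀ {x} → x ≉ 0# → Inverse.from φ x ≉ 0#) →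
           ∀ {h} → (∀ {u v} → Pointwise _≈_ u v → h u ≡ h v) →
           ∑ᵀ m (λ v → h (Vec.map (Inverse.to φ) v)) ≡ ∑ᵀ m h
  ∑ᵀ-map zero    φ to≉0 from≉0     h-cong = ≡.refl
  ∑ᵀ-map (suc m) φ to≉0 from≉0 {h} h-cong = begin
    ∑ᵀ (suc m) (λ v → h (Vec.map to v))
      ≡⟨ ∑ᵀ-suc m _ ⟩
    ∑F* (λ a → ∑ᵀ m (λ v → h (to a ∷ Vec.map to v)))
      ≡⟨ ∑-cong nonzero (λ a → ∑ᵀ-map m φ to≉0 from≉0 (λ u≈v → h-cong (refl ∷ u≈v))) ⟩
    ∑F* (λ a → ∑ᵀ m (λ v → h (to a ∷ v)))
      ≡⟨ ∑F*-bijection φ (λ a≈b → ∑-cong (tuples m) (λ v →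
         h-cong (a≈b ∷ Pointwise.refl refl))) to≉0 from≉0 ⟩
    ∑F* (λ a → ∑ᵀ m (λ v → h (a ∷ v)))
      ≡⟨ ≡.sym (∑ᵀ-suc m h) ⟩
    ∑ᵀ (suc m) h
      ∎
    where
    open ≡.≡-Reasoning
    open Inverse φ using (to)

  ∑ᵀ-character : ∀ m {χ : Carrier → ℤ} → χ 0# ≡ + 1 → (∀ a b → χ (a + b) ≡ χ a ℤ.* χ b) →
                 ∑ᵀ m (λ v → χ (sumF v)) ≡ ∑F* χ ℤ.^ m
  ∑ᵀ-character zero    χ0≡1 χ-+ = ≡.trans (ℤₚ.+-identityʳ _) χ0≡1
  ∑ᵀ-character (suc m) {χ} χ0≡1 χ-+ = begin
    ∑ᵀ (suc m) (λ v → χ (sumF v))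
      ≡⟨ ∑ᵀ-suc m _ ⟩
    ∑F* (λ a → ∑ᵀ m (λ v → χ (a + sumF v)))
      ≡⟨ ∑-cong nonzero (λ a → ≡.trans (∑-cong (tuples m) (λ v → χ-+ a _))
         (∑-*ˡ (tuples m) (χ a) _)) ⟩
    ∑F* (λ a → χ a ℤ.* ∑ᵀ m (λ v → χ (sumF v)))
      ≡⟨ ∑-*ʳ nonzero _ χ ⟩
    ∑F* χ ℤ.* ∑ᵀ m (λ v → χ (sumF v))
      ≡⟨ ≡.cong (λ i → ∑F* χ ℤ.* i) (∑ᵀ-character m χ0≡1 χ-+) ⟩
    ∑F* χ ℤ.* ∑F* χ ℤ.^ m
      ∎
    where open ≡.≡-Reasoning

  σ≡∑ᵀ : ∀ m β → + σ m β ≡ ∑ᵀ m (λ v → 𝟙 ((sumF v + sumInv′ v) ≟ β))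
  σ≡∑ᵀ m β = ≡.trans (length-filter (λ v → (sumF v + sumInv v) ≟ β) (tuples m))
    (∑ᵀ-cong-≉0 m (λ v v≉0 → 𝟙-⇔ ((sumF v + sumInv v) ≟ β) ((sumF v + sumInv′ v) ≟ β)
      (trans (+-congˡ (sym (sumInv≈sumInv′ v≉0)))) (trans (+-congˡ (sumInv≈sumInv′ v≉0)))))

  S≡∑ᵀ : ∀ m β → S m β ≡ ∑ᵀ m (λ v → lam (sumF v) ℤ.* 𝟙 (sumInv′ v ≟ β))
  S≡∑ᵀ m β = ≡.trans (∑-filter (λ v → sumInv v ≟ β) (tuples m) (λ v → lam (sumF v)))
    (∑ᵀ-cong-≉0 m (λ v v≉0 → ≡.trans (if≡*𝟙 (sumInv v ≟ β) _) (≡.cong (λ i → lam (sumF v) ℤ.* i)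
      (𝟙-⇔ (sumInv v ≟ β) (sumInv′ v ≟ β) (trans (sym (sumInv≈sumInv′ v≉0))) (trans (sumInv≈sumInv′ v≉0))))))

  ∑ᵀ-ones : ∀ m → ∑ᵀ m (λ _ → + 1) ≡ (+ q ℤ.- + 1) ℤ.^ m
  ∑ᵀ-ones m = begin
    ∑ᵀ m (λ _ → + 1)           ≡⟨ ∑ᵀ-character m ≡.refl (λ _ _ → ≡.refl) ⟩
    ∑F* (λ _ → + 1) ℤ.^ m      ≡⟨ ≡.cong (ℤ._^ m) (∑-ones nonzero) ⟩
    (+ length nonzero) ℤ.^ m   ≡⟨ ≡.cong (ℤ._^ m) |F*|≡q-1 ⟩
    (+ q ℤ.- + 1) ℤ.^ m        ∎
    where open ≡.≡-Reasoning

  ∑ᵀ-lam : ∀ m → ∑ᵀ m (λ v → lam (sumF v)) ≡ -1ℤ ℤ.^ m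
  ∑ᵀ-lam m = ≡.trans (∑ᵀ-character m lam-0 lam-+) (≡.cong (ℤ._^ m) ∑F*-lam)

  q*σ≡∑F∑ᵀ : ∀ m β → + q ℤ.* + σ m β ≡ ∑F (λ y → ∑ᵀ m (λ v → lam (y * (sumF v + sumInv′ v + β))))
  q*σ≡∑F∑ᵀ m β = begin
    + q ℤ.* + σ m β
      ≡⟨ ≡.cong (λ i → + q ℤ.* i) (σ≡∑ᵀ m β) ⟩
    + q ℤ.* ∑ᵀ m (λ v → 𝟙 (a v ≟ β))
      ≡⟨ ≡.sym (∑-*ˡ (tuples m) (+ q) _) ⟩
    ∑ᵀ m (λ v → + q ℤ.* 𝟙 (a v ≟ β))
      ≡⟨ ∑-cong (tuples m) (λ v → ≡.sym (≡.trans (orthogonality (a v + β))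
         (≡.cong (λ i → + q ℤ.* i) (𝟙-⇔ ((a v + β) ≟ 0#) (a v ≟ β) +≈0⇒≈ ≈⇒+≈0)))) ⟩
    ∑ᵀ m (λ v → ∑F (λ y → lam (y * (a v + β))))
      ≡⟨ ∑-swap (tuples m) elems _ ⟩
    ∑F (λ y → ∑ᵀ m (λ v → lam (y * (a v + β))))
      ∎
    where
    open ≡.≡-Reasoning
    a : Vec Carrier m → Carrier
    a v = sumF v + sumInv′ v

  lam-rescale : ∀ {y} → y ≉ 0# → ∀ s t β →
                lam (y * (y ⁻¹ * s + y * t + β)) ≡ lam s ℤ.* lam ((y * y) * (t + β * β))
  lam-rescale {y} y≉0 s t β = begin
    lam (y * (y ⁻¹ * s + y * t + β))        ≡⟨ lam-cong expand ⟩
    lam (s + ((y * y) * t + y * β))         ≡⟨ lam-+ s _ ⟩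
    lam s ℤ.* lam ((y * y) * t + y * β)     ≡⟨ ≡.cong (λ i → lam s ℤ.* i) yβ-squared ⟩
    lam s ℤ.* lam ((y * y) * (t + β * β))   ∎
    where
    open ≡.≡-Reasoning
    yβ-squared : lam ((y * y) * t + y * β) ≡ lam ((y * y) * (t + β * β))
    yβ-squared = begin
      lam ((y * y) * t + y * β)
        ≡⟨ lam-+ _ _ ⟩
      lam ((y * y) * t) ℤ.* lam (y * β)
        ≡⟨ ≡.cong (λ i → lam ((y * y) * t) ℤ.* i) (≡.sym (lam-square (y * β))) ⟩
      lam ((y * y) * t) ℤ.* lam ((y * β) * (y * β))
        ≡⟨ ≡.sym (lam-+ _ _) ⟩
      lam ((y * y) * t + (y * β) * (y * β))
        ≡⟨ lam-cong (trans (+-congˡ (square-* y β)) (sym (distribˡ _ t _))) ⟩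
      lam ((y * y) * (t + β * β))
        ∎
    expand : y * (y ⁻¹ * s + y * t + β) ≈ s + ((y * y) * t + y * β)
    expand = ≈-Reasoning.begin
      y * (y ⁻¹ * s + y * t + β)
        ≈-Reasoning.≈⟨ distribˡ y _ β ⟩
      y * (y ⁻¹ * s + y * t) + y * β
        ≈-Reasoning.≈⟨ +-congʳ (distribˡ y _ _) ⟩
      y * (y ⁻¹ * s) + y * (y * t) + y * β
        ≈-Reasoning.≈⟨ +-congʳ (+-cong (*-⁻¹-cancelˡ y≉0 s) (sym (*-assoc y y t))) ⟩
      s + (y * y) * t + y * β
        ≈-Reasoning.≈⟨ +-assoc s _ _ ⟩
      s + ((y * y) * t + y * β)
        ≈-Reasoning.∎

  ∑ᵀ-lam-scaled : ∀ m β {y} → y ≉ 0# →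
                  ∑ᵀ m (λ v → lam (y * (sumF v + sumInv′ v + β))) ≡
                  ∑ᵀ m (λ w → lam (sumF w) ℤ.* lam ((y * y) * (sumInv′ w + β * β)))
  ∑ᵀ-lam-scaled m β {y} y≉0 = begin
    ∑ᵀ m h
      ≡⟨ ≡.sym (∑ᵀ-map m (scaling y⁻¹≉0) (*-≉0 y⁻¹≉0) (*-≉0 (⁻¹-≉0 y⁻¹≉0)) h-cong) ⟩
    ∑ᵀ m (λ w → h (Vec.map (y ⁻¹ *_) w))
      ≡⟨ ∑-cong (tuples m) (λ w → ≡.trans (lam-cong (*-congˡ (+-congʳ
         (+-cong (sumF-scale _ w) (trans (sumInv′-scale _ w) (*-congʳ (⁻¹-involutive y)))))))
         (lam-rescale y≉0 _ _ β)) ⟩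
    ∑ᵀ m (λ w → lam (sumF w) ℤ.* lam ((y * y) * (sumInv′ w + β * β))) ∎
    where
    open ≡.≡-Reasoning
    y⁻¹≉0 = ⁻¹-≉0 y≉0
    h : Vec Carrier m → ℤ
    h v = lam (y * (sumF v + sumInv′ v + β))
    h-cong : ∀ {u v} → Pointwise _≈_ u v → h u ≡ h v
    h-cong u≈v = lam-cong (*-congˡ (+-congʳ (+-cong (sumF-cong u≈v) (sumInv′-cong u≈v))))

  S≡∑ᵀ-β² : ∀ m β → S m β ≡ ∑ᵀ m (λ w → lam (sumF w) ℤ.* 𝟙 ((sumInv′ w + β * β) ≟ 0#))
  S≡∑ᵀ-β² m β = begin
    S m β
      ≡⟨ S≡∑ᵀ m β ⟩
    ∑ᵀ m (λ w → lam (sumF w) ℤ.* 𝟙 (sumInv′ w ≟ β))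
      ≡⟨ ∑-cong (tuples m) (λ w → ≡.sym (≡.cong₂ ℤ._*_ (≡.trans (lam-cong (sumF-square w)) (lam-square _))
           (𝟙-⇔ ((sumInv′ (Vec.map square w) + β * β) ≟ 0#) (sumInv′ w ≟ β)
                (λ P → square-injective (trans (sym (sumInv′-square w)) (+≈0⇒≈ P)))
                (λ Q → ≈⇒+≈0 (trans (sumInv′-square w) (*-cong Q Q)))))) ⟩
    ∑ᵀ m (λ w → h (Vec.map square w))
      ≡⟨ ∑ᵀ-map m squaring (λ y≉0 → *-≉0 y≉0 y≉0) √-≉0 h-cong ⟩
    ∑ᵀ m h
      ∎
    where
    open ≡.≡-Reasoning
    square = λ (x : Carrier) → x * x
    h : Vec Carrier m → ℤ
    h w = lam (sumF w) ℤ.* 𝟙 ((sumInv′ w + β * β) ≟ 0#)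
    h-cong : ∀ {u v} → Pointwise _≈_ u v → h u ≡ h v
    h-cong {u} {v} u≈v = ≡.cong₂ ℤ._*_ (lam-cong (sumF-cong u≈v))
      (𝟙-⇔ ((sumInv′ u + β * β) ≟ 0#) ((sumInv′ v + β * β) ≟ 0#)
           (trans (+-congʳ (sym (sumInv′-cong u≈v)))) (trans (+-congʳ (sumInv′-cong u≈v))))

  σ-formula : ∀ m β → + q ℤ.* + σ m β ≡ + q ℤ.* S m β ℤ.+ ((+ q ℤ.- + 1) ℤ.^ m ℤ.+ -1ℤ ℤ.^ suc m)
  σ-formula m β = begin
    + q ℤ.* + σ m β
      ≡⟨ q*σ≡∑F∑ᵀ m β ⟩
    ∑F G
      ≡⟨ ∑F-split (λ y≈z → ∑-cong (tuples m) (λ v → lam-cong (*-congʳ y≈z))) ⟩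
    G 0# ℤ.+ ∑F* G
      ≡⟨ ≡.cong₂ ℤ._+_ G0≡A (∑-cong-∈ nonzero (λ y∈ → ∑ᵀ-lam-scaled m β (∈nonzero⇒≉0 (∈ₚ⇒∈ y∈)))) ⟩
    A ℤ.+ ∑F* (λ y → ∑ᵀ m (λ w → lam (sumF w) ℤ.* lam ((y * y) * c w)))
      ≡⟨ ≡.cong (λ i → A ℤ.+ i) (≡.trans (∑-swap nonzero (tuples m) _) (∑-cong (tuples m) (λ w →
           ≡.trans (∑-*ˡ nonzero (lam (sumF w)) _) (≡.cong (λ i → lam (sumF w) ℤ.* i) (∑F*-lam-square (c w)))))) ⟩
    A ℤ.+ ∑ᵀ m (λ w → lam (sumF w) ℤ.* (+ q ℤ.* 𝟙 (c w ≟ 0#) ℤ.- + 1))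
      ≡⟨ ≡.cong (λ i → A ℤ.+ i) (≡.trans (∑-cong (tuples m) (λ w → distribute (lam (sumF w)) (+ q) (𝟙 (c w ≟ 0#))))
           (≡.trans (∑-∙ (tuples m) (λ w → + q ℤ.* (lam (sumF w) ℤ.* 𝟙 (c w ≟ 0#))) (λ w → -1ℤ ℤ.* lam (sumF w)))
             (≡.cong₂ ℤ._+_ (∑-*ˡ (tuples m) (+ q) _) (∑-*ˡ (tuples m) -1ℤ _)))) ⟩
    A ℤ.+ (+ q ℤ.* ∑ᵀ m (λ w → lam (sumF w) ℤ.* 𝟙 (c w ≟ 0#)) ℤ.+ -1ℤ ℤ.* ∑ᵀ m (λ w → lam (sumF w)))
      ≡⟨ ≡.cong₂ (λ s e → A ℤ.+ (+ q ℤ.* s ℤ.+ -1ℤ ℤ.* e)) (≡.sym (S≡∑ᵀ-β² m β)) (∑ᵀ-lam m) ⟩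
    A ℤ.+ (+ q ℤ.* S m β ℤ.+ -1ℤ ℤ.* -1ℤ ℤ.^ m)
      ≡⟨ rearrange A (+ q) (S m β) (-1ℤ ℤ.^ m) ⟩
    + q ℤ.* S m β ℤ.+ (A ℤ.+ -1ℤ ℤ.^ suc m)
      ∎
    where
    open ≡.≡-Reasoning
    A = (+ q ℤ.- + 1) ℤ.^ m
    G : Carrier → ℤ
    G y = ∑ᵀ m (λ v → lam (y * (sumF v + sumInv′ v + β)))
    c : Vec Carrier m → Carrier
    c w = sumInv′ w + β * β
    G0≡A : G 0# ≡ A
    G0≡A = ≡.trans (∑-cong (tuples m) (λ v → ≡.trans (lam-cong (zeroˡ _)) lam-0)) (∑ᵀ-ones m)
    distribute : ∀ l Q i → l ℤ.* (Q ℤ.* i ℤ.- + 1) ≡ Q ℤ.* (l ℤ.* i) ℤ.+ -1ℤ ℤ.* l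
    distribute = ℤSolver.solve-∀
    rearrange : ∀ A Q S E → A ℤ.+ (Q ℤ.* S ℤ.+ -1ℤ ℤ.* E) ≡ Q ℤ.* S ℤ.+ (A ℤ.+ -1ℤ ℤ.* E)
    rearrange = ℤSolver.solve-∀

  S-inverted : ∀ m β → S m β ≡ ∑ᵀ m (λ v → lam (sumInv′ v) ℤ.* 𝟙 (sumF v ≟ β))
  S-inverted m β = ≡.trans (S≡∑ᵀ m β) (≡.trans (≡.sym (∑ᵀ-map m inversion ⁻¹-≉0 ⁻¹-≉0 h-cong))
    (∑-cong (tuples m) (λ v → ≡.cong (λ i → lam (sumInv′ v) ℤ.* i)
      (𝟙-⇔ (sumInv′ (Vec.map _⁻¹ v) ≟ β) (sumF v ≟ β)
           (trans (sym (sumInv′-inverse v))) (trans (sumInv′-inverse v))))))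
    where
    h : Vec Carrier m → ℤ
    h v = lam (sumF v) ℤ.* 𝟙 (sumInv′ v ≟ β)
    h-cong : ∀ {u v} → Pointwise _≈_ u v → h u ≡ h v
    h-cong {u} {v} u≈v = ≡.cong₂ ℤ._*_ (lam-cong (sumF-cong u≈v))
      (𝟙-⇔ (sumInv′ u ≟ β) (sumInv′ v ≟ β) (trans (sym (sumInv′-cong u≈v))) (trans (sumInv′-cong u≈v)))

  S₂≡∑F* : ∀ β → S 2 β ≡ ∑F* (λ a → lam (a ⁻¹ + (a + β) ⁻¹) ℤ.* 𝟙 (¬? ((a + β) ≟ 0#)))
  S₂≡∑F* β = begin
    S 2 β
      ≡⟨ S-inverted 2 β ⟩
    ∑ᵀ 2 (λ v → lam (sumInv′ v) ℤ.* 𝟙 (sumF v ≟ β))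
      ≡⟨ ≡.trans (∑ᵀ-suc 1 _) (∑-cong nonzero (λ a → ∑ᵀ-suc 0 _)) ⟩
    ∑F* (λ a → ∑F* (λ b → lam (a ⁻¹ + (b ⁻¹ + 0#)) ℤ.* 𝟙 ((a + (b + 0#)) ≟ β) ℤ.+ + 0))
      ≡⟨ ∑-cong nonzero (λ a → ∑-cong nonzero (λ b → ≡.trans (ℤₚ.+-identityʳ _) (≡.cong₂ ℤ._*_
           (lam-cong (+-congˡ (+-identityʳ _)))
           (𝟙-⇔ ((a + (b + 0#)) ≟ β) (b ≟ (a + β))
                (λ eq → trans (sym (x+[x+y]≈y a b)) (+-congˡ (trans (+-congˡ (sym (+-identityʳ b))) eq)))
                (λ eq → trans (+-congˡ (trans (+-identityʳ b) eq)) (x+[x+y]≈y a β)))))) ⟩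
    ∑F* (λ a → ∑F* (λ b → lam (a ⁻¹ + b ⁻¹) ℤ.* 𝟙 (b ≟ (a + β))))
      ≡⟨ ∑-cong nonzero (λ a → ∑F*-point (λ b≈c → lam-cong (+-congˡ (⁻¹-cong b≈c))) (a + β)) ⟩
    ∑F* (λ a → lam (a ⁻¹ + (a + β) ⁻¹) ℤ.* 𝟙 (¬? ((a + β) ≟ 0#)))
      ∎
    where open ≡.≡-Reasoning

  S₂-0 : S 2 0# ≡ + q ℤ.- + 1
  S₂-0 = begin
    S 2 0#
      ≡⟨ S₂≡∑F* 0# ⟩
    ∑F* (λ a → lam (a ⁻¹ + (a + 0#) ⁻¹) ℤ.* 𝟙 (¬? ((a + 0#) ≟ 0#)))
      ≡⟨ ∑-cong-∈ nonzero (λ a∈ → term≡1 (∈nonzero⇒≉0 (∈ₚ⇒∈ a∈))) ⟩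
    ∑F* (λ _ → + 1)
      ≡⟨ ∑-ones nonzero ⟩
    + length nonzero
      ≡⟨ |F*|≡q-1 ⟩
    + q ℤ.- + 1
      ∎
    where
    open ≡.≡-Reasoning
    term≡1 : ∀ {a} → a ≉ 0# → lam (a ⁻¹ + (a + 0#) ⁻¹) ℤ.* 𝟙 (¬? ((a + 0#) ≟ 0#)) ≡ + 1
    term≡1 {a} a≉0 = ≡.cong₂ ℤ._*_
      (≡.trans (lam-cong (trans (+-congˡ (⁻¹-cong (+-identityʳ a))) (x+x≈0 _))) lam-0)
      (𝟙-yes (¬? ((a + 0#) ≟ 0#)) (≉0-resp-≈ (sym (+-identityʳ a)) a≉0))

  ∑F*-lam[β/t] : ∀ {β} → β ≉ 0# → ∑F* (λ t → lam (β * t ⁻¹)) ≡ -1ℤ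
  ∑F*-lam[β/t] {β} β≉0 = begin
    ∑F* (λ t → lam (β * t ⁻¹))   ≡⟨ ∑F*-inversion (λ s≈t → lam-cong (*-congˡ s≈t)) ⟩
    ∑F* (λ t → lam (β * t))      ≡⟨ ∑F*-scaling β≉0 lam-cong ⟩
    ∑F* lam                      ≡⟨ ∑F*-lam ⟩
    -1ℤ                          ∎
    where open ≡.≡-Reasoning

  ∑F*-lam[β/t]lam[t/β²] : ∀ {β} → β ≉ 0# → ∑F* (λ t → lam (β * t ⁻¹) ℤ.* lam ((β * β) ⁻¹ * t)) ≡ K (inv β)
  ∑F*-lam[β/t]lam[t/β²] {β} β≉0 = begin
    ∑F* G                          ≡⟨ ≡.sym (∑F*-scaling (*-≉0 β≉0 β≉0) G-cong) ⟩
    ∑F* (λ α → G ((β * β) * α))    ≡⟨ ∑-cong-∈ nonzero (λ α∈ → G[ββα]≡ (∈nonzero⇒≉0 (∈ₚ⇒∈ α∈))) ⟩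
    K (inv β)                      ∎
    where
    open ≡.≡-Reasoning
    G : Carrier → ℤ
    G t = lam (β * t ⁻¹) ℤ.* lam ((β * β) ⁻¹ * t)
    G-cong : G Preserves _≈_ ⟶ _≡_
    G-cong s≈t = ≡.cong₂ ℤ._*_ (lam-cong (*-congˡ (⁻¹-cong s≈t))) (lam-cong (*-congˡ s≈t))
    β[ββα]⁻¹≈ : ∀ {α} → α ≉ 0# → β * ((β * β) * α) ⁻¹ ≈ inv β * inv α
    β[ββα]⁻¹≈ {α} α≉0 = ≈-Reasoning.begin
      β * ((β * β) * α) ⁻¹
        ≈-Reasoning.≈⟨ *-congˡ (trans (⁻¹-distrib-* _ α) (*-congʳ (⁻¹-distrib-* β β))) ⟩
      β * (β ⁻¹ * β ⁻¹ * α ⁻¹)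
        ≈-Reasoning.≈⟨ *-congˡ (*-assoc _ _ _) ⟩
      β * (β ⁻¹ * (β ⁻¹ * α ⁻¹))
        ≈-Reasoning.≈⟨ *-⁻¹-cancelˡ β≉0 _ ⟩
      β ⁻¹ * α ⁻¹
        ≈-Reasoning.≈⟨ sym (*-cong (inv≈⁻¹ β≉0) (inv≈⁻¹ α≉0)) ⟩
      inv β * inv α
        ≈-Reasoning.∎
    G[ββα]≡ : ∀ {α} → α ≉ 0# → G ((β * β) * α) ≡ lam (α + inv β * inv α)
    G[ββα]≡ {α} α≉0 = begin
      lam (β * ((β * β) * α) ⁻¹) ℤ.* lam ((β * β) ⁻¹ * ((β * β) * α))
        ≡⟨ ≡.cong₂ ℤ._*_ (lam-cong (β[ββα]⁻¹≈ α≉0)) (lam-cong (⁻¹-*-cancelˡ (*-≉0 β≉0 β≉0) α)) ⟩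
      lam (inv β * inv α) ℤ.* lam α
        ≡⟨ ≡.trans (ℤₚ.*-comm (lam (inv β * inv α)) (lam α)) (≡.sym (lam-+ α (inv β * inv α))) ⟩
      lam (α + inv β * inv α)
        ∎

  -- With t = a² + β a = a (a + β), the summand of S₂≡∑F* is λ(β / t); each t has 1 + λ(t / β²)
  -- preimages a.
  S₂-≉0 : ∀ {β} → β ≉ 0# → S 2 β ≡ -1ℤ ℤ.+ K (inv β)
  S₂-≉0 {β} β≉0 = begin
    S 2 β
      ≡⟨ S₂≡∑F* β ⟩
    ∑F* (λ a → lam (a ⁻¹ + (a + β) ⁻¹) ℤ.* 𝟙 (¬? ((a + β) ≟ 0#)))
      ≡⟨ ∑-cong-∈ nonzero (λ a∈ → term≡F∘g (∈nonzero⇒≉0 (∈ₚ⇒∈ a∈))) ⟩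
    ∑F* (λ a → F (g a))
      ≡⟨ ≡.sym (≡.trans (∑F-split (F-cong ∘ g-cong))
         (≡.trans (≡.cong (ℤ._+ ∑F* (λ a → F (g a))) F[g0]≡0) (ℤₚ.+-identityˡ _))) ⟩
    ∑F (λ a → F (g a))
      ≡⟨ ∑F-fibres g F-cong ⟩
    ∑F (λ t → F t ℤ.* #fibre g t)
      ≡⟨ ∑-cong elems (λ t → ≡.trans (≡.cong (λ i → F t ℤ.* i) (#fibre-quadratic β≉0 t))
           (≡.trans (ℤₚ.*-distribˡ-+ (F t) (+ 1) (lam ((β * β) ⁻¹ * t)))
             (≡.cong (λ i → i ℤ.+ F t ℤ.* lam ((β * β) ⁻¹ * t)) (ℤₚ.*-identityʳ (F t))))) ⟩
    ∑F (λ t → F t ℤ.+ F t ℤ.* lam ((β * β) ⁻¹ * t))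
      ≡⟨ ∑-∙ elems F _ ⟩
    ∑F F ℤ.+ ∑F (λ t → F t ℤ.* lam ((β * β) ⁻¹ * t))
      ≡⟨ ≡.cong₂ ℤ._+_ (≡.trans (∑F-restrict (λ s≈t → lam-cong (*-congˡ (⁻¹-cong s≈t)))) (∑F*-lam[β/t] β≉0))
           (≡.trans (∑-cong elems (λ t → xy∙z≈xz∙y (lam (β * t ⁻¹)) _ _))
             (≡.trans (∑F-restrict (λ s≈t → ≡.cong₂ ℤ._*_ (lam-cong (*-congˡ (⁻¹-cong s≈t))) (lam-cong (*-congˡ s≈t))))
               (∑F*-lam[β/t]lam[t/β²] β≉0))) ⟩
    -1ℤ ℤ.+ K (inv β)
      ∎
    where
    open ≡.≡-Reasoning
    open CommutativeSemigroupProperties ℤₚ.*-commutativeSemigroup using (xy∙z≈xz∙y)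
    g : Carrier → Carrier
    g a = a * a + β * a
    g-cong : ∀ {x y} → x ≈ y → g x ≈ g y
    g-cong x≈y = +-cong (*-cong x≈y x≈y) (*-congˡ x≈y)
    F : Carrier → ℤ
    F t = lam (β * t ⁻¹) ℤ.* 𝟙 (¬? (t ≟ 0#))
    F-cong : ∀ {s t} → s ≈ t → F s ≡ F t
    F-cong {s} {t} s≈t = *𝟙-cong (¬? (s ≟ 0#)) (¬? (t ≟ 0#)) (≉0-resp-≈ s≈t) (≉0-resp-≈ (sym s≈t))
                                 (λ _ → lam-cong (*-congˡ (⁻¹-cong s≈t)))
    F[g0]≡0 : F (g 0#) ≡ + 0
    F[g0]≡0 = ≡.trans (≡.cong (λ i → lam (β * g 0# ⁻¹) ℤ.* i) (𝟙-no (¬? (g 0# ≟ 0#))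
                        (λ g0≉0 → g0≉0 (trans (+-cong (zeroˡ 0#) (zeroʳ β)) (+-identityʳ 0#)))))
                      (ℤₚ.*-zeroʳ (lam (β * g 0# ⁻¹)))
    g≈a[a+β] : ∀ a → g a ≈ a * (a + β)
    g≈a[a+β] a = trans (+-congˡ (*-comm β a)) (sym (distribˡ a a β))
    term≡F∘g : ∀ {a} → a ≉ 0# → lam (a ⁻¹ + (a + β) ⁻¹) ℤ.* 𝟙 (¬? ((a + β) ≟ 0#)) ≡ F (g a)
    term≡F∘g {a} a≉0 = *𝟙-cong (¬? ((a + β) ≟ 0#)) (¬? (g a ≟ 0#))
      (λ a+β≉0 → ≉0-resp-≈ (sym (g≈a[a+β] a)) (*-≉0 a≉0 a+β≉0))
      (λ ga≉0 a+β≈0 → ga≉0 (trans (g≈a[a+β] a) (trans (*-congˡ a+β≈0) (zeroʳ a))))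
      (λ a+β≉0 → lam-cong (trans (⁻¹-+ a≉0 a+β≉0) (*-cong (x+[x+y]≈y a β) (⁻¹-cong (sym (g≈a[a+β] a))))))

  σ₂≡S₂+q-2 : ∀ β → + σ 2 β ≡ S 2 β ℤ.+ (+ q ℤ.- + 2)
  σ₂≡S₂+q-2 β = ℤₚ.*-cancelˡ-≡ (+ q) _ _ {{ℕ.>-nonZero (ℕₚ.m^n>0 2 r)}}
    (≡.trans (σ-formula 2 β) (factor (+ q) (S 2 β)))
    where
    -- (x - 1)² + (-1)³ with the powers unfolded, as the ring solver does not see through ℤ._^_
    factor : ∀ x y → x ℤ.* y ℤ.+ ((x ℤ.- + 1) ℤ.* ((x ℤ.- + 1) ℤ.* + 1) ℤ.+ -1ℤ ℤ.* (-1ℤ ℤ.* (-1ℤ ℤ.* + 1)))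
                     ≡ x ℤ.* (y ℤ.+ (x ℤ.- + 2))
    factor = ℤSolver.solve-∀

  σ₂-0 : + σ 2 0# ≡ + 2 ℤ.* + q ℤ.- + 3
  σ₂-0 = ≡.trans (σ₂≡S₂+q-2 0#) (≡.trans (≡.cong (ℤ._+ (+ q ℤ.- + 2)) S₂-0) (simplify (+ q)))
    where
    simplify : ∀ Q → Q ℤ.- + 1 ℤ.+ (Q ℤ.- + 2) ≡ + 2 ℤ.* Q ℤ.- + 3
    simplify = ℤSolver.solve-∀

  σ₂-≉0 : ∀ β → β ≉ 0# → + σ 2 β ≡ K (inv β) ℤ.+ + q ℤ.- + 3
  σ₂-≉0 β β≉0 = ≡.trans (σ₂≡S₂+q-2 β) (≡.trans (≡.cong (ℤ._+ (+ q ℤ.- + 2)) (S₂-≉0 β≉0)) (simplify (K (inv β)) (+ q)))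
    where
    simplify : ∀ k Q → -1ℤ ℤ.+ k ℤ.+ (Q ℤ.- + 2) ≡ k ℤ.+ Q ℤ.- + 3
    simplify = ℤSolver.solve-∀

proposition18 : (R : CommutativeRing 0ℓ 0ℓ)
    → (_≟_ : Decidable (CommutativeRing._≈_ R))
    → (elems : List (CommutativeRing.Carrier R))
    → (inv : CommutativeRing.Carrier R → CommutativeRing.Carrier R)
    → (r : ℕ)
    → FF.IsFiniteFieldOfOrder2^ R _≟_ elems inv r
    → ((m : ℕ) → (β : CommutativeRing.Carrier R) → 1 ℕ.≤ m
         → + FF.q R _≟_ elems inv r ℤ.* + FF.σ R _≟_ elems inv r m β
           ≡ + FF.q R _≟_ elems inv r ℤ.* FF.S R _≟_ elems inv r m β
             ℤ.+ ((+ FF.q R _≟_ elems inv r ℤ.- + 1) ℤ.^ m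
                  ℤ.+ (ℤ.- + 1) ℤ.^ suc m))
      × (+ FF.σ R _≟_ elems inv r 2 (CommutativeRing.0# R)
           ≡ + 2 ℤ.* + FF.q R _≟_ elems inv r ℤ.- + 3)
      × ((β : CommutativeRing.Carrier R) → ¬ CommutativeRing._≈_ R β (CommutativeRing.0# R)
         → + FF.σ R _≟_ elems inv r 2 β
           ≡ FF.K R _≟_ elems inv r (inv β) ℤ.+ + FF.q R _≟_ elems inv r ℤ.- + 3)
proposition18 R _≟_ elems inv r isField = (λ m β _ → σ-formula m β) , σ₂-0 , σ₂-≉0
  where open FiniteField R _≟_ elems inv r isField
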